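{- Let $G$ be a fixed finite simple graph. Then, as $n\to\infty$, $\mathbb E\big(t(G,K_n^{\pm1})\big)=\Theta\big(n^{ -p(G)}\big)$.
   Context: $K_n$ is the complete graph on $[n]$ without loops. For $w:E(K_n)\to\{ -1,1\}$, $K_n^w$ is $K_n$ with edge weights $w$, and $t(G,K_n^w)=n^{ -|V(G)|}\sum_{\varphi:V(G)\to[n]}\prod_{uv\in E(G)}w_{\varphi(u)\varphi(v)}$, where $w_{xx}=0$ (no loops) and $w_{xy}=w(xy)$ for $x\ne y$. $K_n^{\pm1}$ denotes $K_n^w$ with $w$ chosen uniformly at random, and $\mathbb E$ is expectation over $w$. A homomorphism $f:G\to K_n$ is a map $V(G)\to[n]$ sending adjacent vertices to distinct vertices; it is even if for every edge $xy$ of $K_n$ the number of edges $uv\in E(G)$ with $\{f(u),f(v)\}=\{x,y\}$ is even. $p(G)=\min\{|V(G)|-|f(V(G))|: f:G\to K_n \text{ an even homomorphism}\}$ (independent of $n$ for $n\ge|V(G)|$; if no even homomorphism exists, $p(G)=+\infty$ and $n^{ -p(G)}$ is read as $0$). -}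

module Defs where

open import Data.Bool using (Bool; true; false; if_then_else_; _∧_; _∨_)
open import Data.Nat as ℕ using (ℕ; zero; suc; _^_; _∸_; NonZero; _<ᵇ_)
open import Data.Nat.Properties using (m^n≢0)
open import Data.Nat.Divisibility using (_∣_)
open import Data.Fin using (Fin; toℕ; _≟_)
open import Data.Fin.Properties using (any?)
open import Data.Integer as ℤ using (ℤ; +_; -[1+_])
open import Data.Rational as ℚ using (ℚ; 0ℚ; _/_)
open import Data.Product using (∃; ∃-syntax; _×_; _,_)
open import Relation.Nullary using (¬_)
open import Relation.Nullary.Decidable using (⌊_⌋)
open import Relation.Binary.PropositionalEquality using (_≡_; _≢_)

sumℤ : (n : ℕ) → (Fin n → ℤ) → ℤ
sumℤ zero    f = + 0
sumℤ (suc n) f = f Fin.zero ℤ.+ sumℤ n (λ i → f (Fin.suc i))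

prodℤ : (n : ℕ) → (Fin n → ℤ) → ℤ
prodℤ zero    f = + 1
prodℤ (suc n) f = f Fin.zero ℤ.* prodℤ n (λ i → f (Fin.suc i))

countFin : (n : ℕ) → (Fin n → Bool) → ℕ
countFin zero    b = 0
countFin (suc n) b = (if b Fin.zero then 1 else 0) ℕ.+ countFin n (λ i → b (Fin.suc i))

sumFunℤ : {B : Set} → ((B → ℤ) → ℤ) → (k : ℕ) → ((Fin k → B) → ℤ) → ℤ
sumFunℤ sumB zero    F = F (λ ())
sumFunℤ sumB (suc k) F =
  sumB (λ b → sumFunℤ sumB k (λ φ → F (λ { Fin.zero → b ; (Fin.suc i) → φ i })))

sumBoolℤ : (Bool → ℤ) → ℤ
sumBoolℤ g = g true ℤ.+ g false

sumFinℤ : (n : ℕ) → (Fin n → ℤ) → ℤ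
sumFinℤ n = sumℤ n

sumFunℚ : {B : Set} → ((B → ℚ) → ℚ) → (k : ℕ) → ((Fin k → B) → ℚ) → ℚ
sumFunℚ sumB zero    F = F (λ ())
sumFunℚ sumB (suc k) F =
  sumB (λ b → sumFunℚ sumB k (λ φ → F (λ { Fin.zero → b ; (Fin.suc i) → φ i })))

sumBoolℚ : (Bool → ℚ) → ℚ
sumBoolℚ g = g true ℚ.+ g false

record Graph : Set where
  field
    k      : ℕ
    adj    : Fin k → Fin k → Bool
    sym    : ∀ u v → adj u v ≡ adj v u
    irrefl : ∀ u → adj u u ≡ false
open Graph public

-- u v is an edge listed once, as the ordered pair with u < v
isEdge : (G : Graph) → Fin (k G) → Fin (k G) → Bool
isEdge G u v = (toℕ u <ᵇ toℕ v) ∧ adj G u v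

-- Edge weightings of K_n with values ±1.
-- A weighting is encoded by bits b : Fin n → Fin n → Bool; only the
-- entries b x y with x < y are used (entry for the edge xy of K_n),
-- so the uniform measure on all b induces the uniform measure on
-- w : E(K_n) → {-1,1}.

Bits : ℕ → Set
Bits n = Fin n → Fin n → Bool

sgn : Bool → ℤ
sgn true  = + 1
sgn false = -[1+ 0 ]

-- w_{xy}; w_{xx} = 0 (no loops)
weight : {n : ℕ} → Bits n → Fin n → Fin n → ℤ
weight b x y =
  if ⌊ x ≟ y ⌋ then + 0
  else (if toℕ x <ᵇ toℕ y then sgn (b x y) else sgn (b y x))

homSum : (G : Graph) (n : ℕ) → Bits n → ℤ
homSum G n b =
  sumFunℤ (sumFinℤ n) (k G) (λ φ →
    prodℤ (k G) (λ u → prodℤ (k G) (λ v →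
      if isEdge G u v then weight b (φ u) (φ v) else + 1)))

t : (G : Graph) (n : ℕ) .{{_ : NonZero n}} → Bits n → ℚ
t G n b = _/_ (homSum G n b) (n ^ k G) {{m^n≢0 n (k G)}}

expect-t : (G : Graph) (n : ℕ) .{{_ : NonZero n}} → ℚ
expect-t G n =
  _/_ (+ 1) (2 ^ (n ℕ.* n)) {{m^n≢0 2 (n ℕ.* n)}}
    ℚ.* sumFunℚ (sumFunℚ sumBoolℚ n) n (λ b → t G n b)

invPow : (n : ℕ) .{{_ : NonZero n}} → ℕ → ℚ
invPow n q = _/_ (+ 1) (n ^ q) {{m^n≢0 n q}}

IsHom : (G : Graph) (n : ℕ) → (Fin (k G) → Fin n) → Set
IsHom G n f = ∀ u v → adj G u v ≡ true → f u ≢ f v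

sumℕ : (n : ℕ) → (Fin n → ℕ) → ℕ
sumℕ zero    f = 0
sumℕ (suc n) f = f Fin.zero ℕ.+ sumℕ n (λ i → f (Fin.suc i))

edgeMult : (G : Graph) (n : ℕ) → (Fin (k G) → Fin n) → Fin n → Fin n → ℕ
edgeMult G n f x y =
  sumℕ (k G) (λ u → countFin (k G) (λ v →
    isEdge G u v ∧
      ((⌊ f u ≟ x ⌋ ∧ ⌊ f v ≟ y ⌋) ∨ (⌊ f u ≟ y ⌋ ∧ ⌊ f v ≟ x ⌋))))

IsEvenHom : (G : Graph) (n : ℕ) → (Fin (k G) → Fin n) → Set
IsEvenHom G n f = IsHom G n f × (∀ x y → x ≢ y → 2 ∣ edgeMult G n f x y)

imageSize : {m n : ℕ} → (Fin m → Fin n) → ℕ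
imageSize {m} {n} f = countFin n (λ x → ⌊ any? (λ u → f u ≟ x) ⌋)

-- p(G) is computed with target K_n for n = |V(G)| (it is independent of
-- n ≥ |V(G)|).  "IsP G q" says p(G) = q (finite); "NoEvenHom G" says p(G) = +∞.
IsP : Graph → ℕ → Set
IsP G q =
  (∃[ f ] (IsEvenHom G (k G) f × k G ∸ imageSize f ≡ q)) ×
  (∀ f → IsEvenHom G (k G) f → q ℕ.≤ k G ∸ imageSize f)

NoEvenHom : Graph → Set
NoEvenHom G = ∀ f → ¬ IsEvenHom G (k G) f

module Submission where

-- Averaging t over the 2^(n²) bit arrays that encode the weights gives
-- E t = #{even homomorphisms G → K_n} / n^|V(G)| (module Expectation): for a
-- fixed map φ the signed product of the edge weights sums to 2^(n²) over all
-- weightings when φ is an even homomorphism and to 0 otherwise.  It vanishes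
-- identically when an edge collapses, flipping the bit of a pair of odd
-- multiplicity is a sign-reversing bijection, and for even φ the product is
-- invariant under every bit flip, hence constantly 1 (EdgeProduct).
-- Evenness only depends on the kernel of φ (KernelInvariance), which gives
-- both counting bounds (CountBounds): #even · n^p ≤ |V|! · n^|V| by weighting
-- maps with few values, and #even ≥ ⌊n/(|V|+1)⌋^(|V|-p) by composing an
-- optimal even f₀ with maps that separate its values by residues.

open import Defs hiding (sym)

module IteratedSums where
  open import Data.Nat.Base using (ℕ; zero; suc)
  open import Data.Fin.Base using (Fin; zero; suc)
  open import Data.Integer.Base using (ℤ)
  open import Data.Rational.Base using (ℚ)
  open import Data.Vec.Functional using (_∷_; head; tail)
  open import Data.Product using (∃; _,_)
  open import Data.Empty using (⊥-elim)
  open import Function.Base using (_∘_)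
  open import Relation.Binary.PropositionalEquality

  variable
    A B C : Set

  sumMaps : ((B → A) → A) → (m : ℕ) → ((Fin m → B) → A) → A
  sumMaps S zero    F = F (λ ())
  sumMaps S (suc m) F = S (λ b → sumMaps S m (λ φ → F (b ∷ φ)))

  Congruent : ((B → A) → A) → Set
  Congruent S = ∀ {g h} → g ≗ h → S g ≡ S h

  sumMaps-cong : {S : (B → A) → A} → Congruent S → ∀ m → Congruent (sumMaps S m)
  sumMaps-cong S-cong zero    eq = eq _
  sumMaps-cong S-cong (suc m) eq = S-cong (λ b → sumMaps-cong S-cong m (λ φ → eq (b ∷ φ)))

  sumMaps-map : {A′ : Set} {S : (B → A) → A} {S′ : (B → A′) → A′} (h : A → A′) →
    Congruent S′ → (∀ g → S′ (h ∘ g) ≡ h (S g)) →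
    ∀ m F → sumMaps S′ m (h ∘ F) ≡ h (sumMaps S m F)
  sumMaps-map h S′-cong base zero    F = refl
  sumMaps-map h S′-cong base (suc m) F =
    trans (S′-cong (λ b → sumMaps-map h S′-cong base m (λ φ → F (b ∷ φ)))) (base _)

  record IsSum (_+_ _*_ : A → A → A) (0# : A) (S : (B → A) → A) : Set where
    field
      cong-S : Congruent S
      +-hom  : ∀ g h → S (λ x → g x + h x) ≡ S g + S h
      *-hom  : ∀ c g → S (λ x → c * g x) ≡ c * S g
      0-hom  : S (λ _ → 0#) ≡ 0#

  sumMaps-isSum : {_+_ _*_ : A → A → A} {0# : A} {S : (B → A) → A} →
    IsSum _+_ _*_ 0# S → ∀ m → IsSum _+_ _*_ 0# (sumMaps S m)
  sumMaps-isSum {A = A} {_+_ = _+_} {_*_} {0#} {S} isSum m = record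
    { cong-S = sumMaps-cong cong-S m ; +-hom = additive m ; *-hom = homogeneous m ; 0-hom = zero-sum m }
    where
    open IsSum isSum
    additive : ∀ m g h → sumMaps S m (λ x → g x + h x) ≡ sumMaps S m g + sumMaps S m h
    additive zero    g h = refl
    additive (suc m) g h = trans (cong-S (λ b → additive m _ _)) (+-hom _ _)
    homogeneous : ∀ m c g → sumMaps S m (λ x → c * g x) ≡ c * sumMaps S m g
    homogeneous zero    c g = refl
    homogeneous (suc m) c g = trans (cong-S (λ b → homogeneous m c _)) (*-hom c _)
    zero-sum : ∀ m → sumMaps S m (λ _ → 0#) ≡ 0#
    zero-sum zero    = refl
    zero-sum (suc m) = trans (cong-S (λ b → zero-sum m)) 0-hom

  Commute : {A B C : Set} → ((B → A) → A) → ((C → A) → A) → Set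
  Commute {A} {B} {C} S T =
    ∀ (H : B → C → A) → S (λ x → T (H x)) ≡ T (λ y → S (λ x → H x y))

  sumMaps-commute : {S : (B → A) → A} {T : (C → A) → A} →
    Congruent S → Commute S T → ∀ m → Commute (sumMaps S m) T
  sumMaps-commute S-cong comm zero    H = refl
  sumMaps-commute {T = T} S-cong comm (suc m) H =
    trans (S-cong (λ b → sumMaps-commute {T = T} S-cong comm m (λ φ → H (b ∷ φ)))) (comm _)

  sumMaps-mono : {_≤_ : A → A → Set} {S : (B → A) → A} →
    (∀ {g h} → (∀ x → g x ≤ h x) → S g ≤ S h) →
    ∀ m {F G} → (∀ f → F f ≤ G f) → sumMaps S m F ≤ sumMaps S m G
  sumMaps-mono S-mono zero    le = le _
  sumMaps-mono {_≤_ = _≤_} S-mono (suc m) le =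
    S-mono (λ b → sumMaps-mono {_≤_ = _≤_} S-mono m (λ φ → le (b ∷ φ)))

  sumMaps-witness : {0# : A} {S : (B → A) → A} →
    (∀ g → S g ≢ 0# → ∃ λ x → g x ≢ 0#) →
    ∀ m F → sumMaps S m F ≢ 0# → ∃ λ f → F f ≢ 0#
  sumMaps-witness S-wit zero    F ne = _ , ne
  sumMaps-witness S-wit (suc m) F ne with S-wit _ ne
  ... | b , ne′ with sumMaps-witness S-wit m _ ne′
  ...   | φ , ne″ = b ∷ φ , ne″

  flipAt : {m : ℕ} → Fin m → (B → B) → (Fin m → B) → (Fin m → B)
  flipAt zero    σ f = σ (head f) ∷ tail f
  flipAt (suc i) σ f = head f ∷ flipAt i σ (tail f)

  flipAt-same : ∀ {m} (i : Fin m) (σ : B → B) f → flipAt i σ f i ≡ σ (f i)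
  flipAt-same zero    σ f = refl
  flipAt-same (suc i) σ f = flipAt-same i σ (tail f)

  flipAt-other : ∀ {m} {i j : Fin m} (σ : B → B) f → j ≢ i → flipAt i σ f j ≡ f j
  flipAt-other {i = zero}  {zero}  σ f ne = ⊥-elim (ne refl)
  flipAt-other {i = zero}  {suc j} σ f ne = refl
  flipAt-other {i = suc i} {zero}  σ f ne = refl
  flipAt-other {i = suc i} {suc j} σ f ne = flipAt-other σ (tail f) (ne ∘ cong suc)

  sumMaps-flip : {S : (B → A) → A} {σ : B → B} → Congruent S → (∀ g → S (g ∘ σ) ≡ S g) →
    ∀ m (i : Fin m) F → sumMaps S m (F ∘ flipAt i σ) ≡ sumMaps S m F
  sumMaps-flip S-cong inv (suc m) zero    F = inv (λ b → sumMaps _ m (λ φ → F (b ∷ φ)))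
  sumMaps-flip S-cong inv (suc m) (suc i) F =
    S-cong (λ b → sumMaps-flip S-cong inv m i (λ φ → F (b ∷ φ)))

  -- Connectivity of product "graphs": if B is connected by the moves
  -- move j, then Fin m → B is connected by the moves flipAt i (move j).
  -- Connectedness is expressed through functions: every function respecting
  -- an equivalence ≈ and invariant under all moves is constant.
  module _ {J : Set} (_≈_ : B → B → Set) (≈-refl : ∀ {b} → b ≈ b) (move : J → B → B) where

    ConnectedBy : Set → Set
    ConnectedBy A = ∀ (G : B → A) → (∀ b c → b ≈ c → G b ≡ G c) →
      (∀ j b → G (move j b) ≡ G b) → ∀ b c → G b ≡ G c

    flip-invariant⇒constant : ConnectedBy A → ∀ m (F : (Fin m → B) → A) →
      (∀ f g → (∀ i → f i ≈ g i) → F f ≡ F g) →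
      (∀ i j f → F (flipAt i (move j) f) ≡ F f) → ∀ f g → F f ≡ F g
    flip-invariant⇒constant conn zero    F resp inv f g = resp f g (λ ())
    flip-invariant⇒constant conn (suc m) F resp inv f g = begin
      F f                    ≡⟨ resp f (head f ∷ tail f) (λ { zero → ≈-refl ; (suc i) → ≈-refl }) ⟩
      F (head f ∷ tail f)    ≡⟨ conn (λ b → F (b ∷ tail f)) respHead (λ j b → inv zero j (b ∷ tail f)) _ _ ⟩
      F (head g ∷ tail f)    ≡⟨ flip-invariant⇒constant conn m (λ φ → F (head g ∷ φ)) respTail
                                  (λ i j φ → inv (suc i) j (head g ∷ φ)) (tail f) (tail g) ⟩
      F (head g ∷ tail g)    ≡⟨ resp _ g (λ { zero → ≈-refl ; (suc i) → ≈-refl }) ⟩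
      F g                    ∎
      where
      open ≡-Reasoning
      respHead : ∀ b c → b ≈ c → F (b ∷ tail f) ≡ F (c ∷ tail f)
      respHead b c b≈c = resp _ _ (λ { zero → b≈c ; (suc i) → ≈-refl })
      respTail : ∀ φ ψ → (∀ i → φ i ≈ ψ i) → F (head g ∷ φ) ≡ F (head g ∷ ψ)
      respTail φ ψ eq = resp _ _ (λ { zero → ≈-refl ; (suc i) → eq i })

  -- The iterated sums sumFunℤ and sumFunℚ used by t and expect-t build their
  -- argument with an anonymous cons, so they agree with sumMaps on every
  -- summand that only depends on the values of its argument.
  sumFunℤ≡sumMaps : {S : (B → ℤ) → ℤ} → Congruent S →
    ∀ m F → (∀ f g → f ≗ g → F f ≡ F g) → sumFunℤ S m F ≡ sumMaps S m F
  sumFunℤ≡sumMaps S-cong zero    F resp = resp _ _ (λ ())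
  sumFunℤ≡sumMaps S-cong (suc m) F resp = S-cong (λ b → trans
    (sumFunℤ≡sumMaps S-cong m _ (λ f g eq → resp _ _ (λ { zero → refl ; (suc i) → eq i })))
    (sumMaps-cong S-cong m (λ φ → resp _ _ (λ { zero → refl ; (suc i) → refl }))))

  sumFunℚ-cong : {S : (B → ℚ) → ℚ} → Congruent S → ∀ m → Congruent (sumFunℚ S m)
  sumFunℚ-cong S-cong zero    eq = eq _
  sumFunℚ-cong S-cong (suc m) eq = S-cong (λ b → sumFunℚ-cong S-cong m (λ φ → eq _))

  sumFunℚ≡sumMaps : (R : B → B → Set) → (∀ {b} → R b b) → {S S′ : (B → ℚ) → ℚ} →
    Congruent S → Congruent S′ → (∀ g → (∀ b c → R b c → g b ≡ g c) → S g ≡ S′ g) →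
    ∀ m F → (∀ f g → (∀ i → R (f i) (g i)) → F f ≡ F g) → sumFunℚ S m F ≡ sumMaps S′ m F
  sumFunℚ≡sumMaps R R-refl S-cong S′-cong agree zero    F resp = resp _ _ (λ ())
  sumFunℚ≡sumMaps R R-refl S-cong S′-cong agree (suc m) F resp =
    trans (S-cong (λ b → trans
            (sumFunℚ≡sumMaps R R-refl S-cong S′-cong agree m _
              (λ f g eq → resp _ _ (λ { zero → R-refl ; (suc i) → eq i })))
            (sumMaps-cong S′-cong m (λ φ → resp _ _ (λ { zero → R-refl ; (suc i) → R-refl })))))
          (agree _ (λ b c bRc → sumMaps-cong S′-cong m
            (λ φ → resp _ _ (λ { zero → bRc ; (suc i) → R-refl }))))

module Decisions where
  open import Data.Bool.Base using (Bool; true; false; if_then_else_)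
  open import Data.Nat.Base using (ℕ)
  open import Function.Bundles using (_⇔_)
  open import Relation.Binary.PropositionalEquality using (_≡_; sym; trans)
  open import Relation.Nullary using (Dec; yes; ¬_; does)
  open import Relation.Nullary.Decidable using (⌊_⌋; isYes≗does; dec-true; dec-false; does-⇔)

  isYes-true : ∀ {P : Set} (d : Dec P) → P → ⌊ d ⌋ ≡ true
  isYes-true d p = trans (isYes≗does d) (dec-true d p)

  isYes-false : ∀ {P : Set} (d : Dec P) → ¬ P → ⌊ d ⌋ ≡ false
  isYes-false d ¬p = trans (isYes≗does d) (dec-false d ¬p)

  isYes-sound : ∀ {P : Set} (d : Dec P) → ⌊ d ⌋ ≡ true → P
  isYes-sound (yes p) _ = p

  does-sound : ∀ {P : Set} (d : Dec P) → does d ≡ true → P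
  does-sound (yes p) _ = p

  isYes-⇔ : ∀ {P Q : Set} → P ⇔ Q → (p? : Dec P) (q? : Dec Q) → ⌊ p? ⌋ ≡ ⌊ q? ⌋
  isYes-⇔ P⇔Q p? q? = trans (isYes≗does p?) (trans (does-⇔ P⇔Q p? q?) (sym (isYes≗does q?)))

  ind : Bool → ℕ
  ind β = if β then 1 else 0

module NatSums where
  open IteratedSums
  open Decisions using (ind)
  import Data.Nat.Properties as ℕP
  open import Algebra.Properties.CommutativeSemigroup ℕP.+-commutativeSemigroup
    using (interchange)
  open import Data.Bool.Base using (Bool)
  open import Data.Empty using (⊥-elim)
  open import Data.Fin.Base using (Fin; zero; suc)
  open import Data.Integer.Base as ℤ using (ℤ)
  import Data.Integer.Properties as ℤP
  open import Data.Nat.Base using (ℕ; zero; suc; _+_; _*_; _≤_; z≤n)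
  open import Data.Nat.Properties using (*-zeroʳ; *-distribˡ-+; +-mono-≤)
  open import Data.Product using (∃; _,_)
  open import Function.Base using (_∘_)
  open import Relation.Binary.PropositionalEquality

  sumℕ-isSum : ∀ n → IsSum _+_ _*_ 0 (sumℕ n)
  sumℕ-isSum n = record { cong-S = cong-sum n ; +-hom = additive n ; *-hom = homogeneous n ; 0-hom = zero-sum n }
    where
    cong-sum : ∀ n → Congruent (sumℕ n)
    cong-sum zero    eq = refl
    cong-sum (suc n) eq = cong₂ _+_ (eq zero) (cong-sum n (eq ∘ suc))
    additive : ∀ n g h → sumℕ n (λ x → g x + h x) ≡ sumℕ n g + sumℕ n h
    additive zero    g h = refl
    additive (suc n) g h = trans (cong (g zero + h zero +_) (additive n (g ∘ suc) (h ∘ suc)))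
                                 (interchange (g zero) (h zero) _ _)
    homogeneous : ∀ n c g → sumℕ n (λ x → c * g x) ≡ c * sumℕ n g
    homogeneous zero    c g = sym (*-zeroʳ c)
    homogeneous (suc n) c g = trans (cong (c * g zero +_) (homogeneous n c (g ∘ suc)))
                                    (sym (*-distribˡ-+ c _ _))
    zero-sum : ∀ n → sumℕ n (λ _ → 0) ≡ 0
    zero-sum zero    = refl
    zero-sum (suc n) = zero-sum n

  sumℕ-commute : ∀ {C} {T : (C → ℕ) → ℕ} → IsSum _+_ _*_ 0 T → ∀ n → Commute (sumℕ n) T
  sumℕ-commute isSum zero    H = sym (IsSum.0-hom isSum)
  sumℕ-commute {T = T} isSum (suc n) H =
    trans (cong (T (H zero) +_) (sumℕ-commute isSum n (H ∘ suc))) (sym (IsSum.+-hom isSum (H zero) _))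

  sumℕ-mono : ∀ n {f g : Fin n → ℕ} → (∀ i → f i ≤ g i) → sumℕ n f ≤ sumℕ n g
  sumℕ-mono zero    le = z≤n
  sumℕ-mono (suc n) le = +-mono-≤ (le zero) (sumℕ-mono n (le ∘ suc))

  sumℕ-witness : ∀ n (g : Fin n → ℕ) → sumℕ n g ≢ 0 → ∃ λ x → g x ≢ 0
  sumℕ-witness zero    g ne = ⊥-elim (ne refl)
  sumℕ-witness (suc n) g ne with g zero in eq
  ... | suc _ = zero , λ g0≡0 → ℕP.1+n≢0 (trans (sym eq) g0≡0)
  ... | zero with sumℕ-witness n (g ∘ suc) ne
  ...   | x , ne′ = suc x , ne′

  countFin≡sumℕ : ∀ n (c : Fin n → Bool) → countFin n c ≡ sumℕ n (ind ∘ c)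
  countFin≡sumℕ zero    c = refl
  countFin≡sumℕ (suc n) c = cong (ind (c zero) +_) (countFin≡sumℕ n (c ∘ suc))

  countFin-cong : ∀ n {f g : Fin n → Bool} → (∀ i → f i ≡ g i) → countFin n f ≡ countFin n g
  countFin-cong zero    eq = refl
  countFin-cong (suc n) eq = cong₂ _+_ (cong ind (eq zero)) (countFin-cong n (eq ∘ suc))

  sumℤ-pos : ∀ n (g : Fin n → ℕ) → sumℤ n (ℤ.+_ ∘ g) ≡ ℤ.+ sumℕ n g
  sumℤ-pos zero    g = refl
  sumℤ-pos (suc n) g =
    trans (cong (ℤ._+_ (ℤ.+ g zero)) (sumℤ-pos n (g ∘ suc))) (sym (ℤP.pos-+ (g zero) _))

module Signs where
  open Decisions using (ind)
  open NatSums using (countFin≡sumℕ)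
  import Data.Integer.Properties as ℤP
  open import Algebra.Properties.CommutativeSemigroup ℤP.*-commutativeSemigroup
    using (interchange)
  open import Data.Bool.Base using (Bool; true; false; if_then_else_)
  open import Data.Empty using (⊥-elim)
  open import Data.Fin.Base using (Fin; zero; suc)
  open import Data.Integer.Base using (ℤ; 0ℤ; 1ℤ; -1ℤ; _*_; -_; _^_)
  open import Data.Nat.Base as ℕ using (ℕ; zero; suc)
  open import Data.Nat.Divisibility using (_∣_; divides; m%n≡0⇒n∣m)
  open import Data.Nat.DivMod using (_%_; _/_; m≡m%n+[m/n]*n; m%n<n)
  open import Data.Nat.Properties using (*-comm)
  open import Function.Base using (_∘_)
  open import Relation.Binary.PropositionalEquality
  open import Relation.Nullary using (¬_)
  open ≡-Reasoning

  -1^-even : ∀ {m} → 2 ∣ m → -1ℤ ^ m ≡ 1ℤ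
  -1^-even (divides q refl) =
    trans (cong (-1ℤ ^_) (*-comm q 2)) (trans (sym (ℤP.^-*-assoc -1ℤ 2 q)) (ℤP.^-zeroˡ q))

  -1^-odd : ∀ {m} → ¬ 2 ∣ m → -1ℤ ^ m ≡ -1ℤ
  -1^-odd {m} ¬2∣m = begin
    -1ℤ ^ m                              ≡⟨ cong (-1ℤ ^_) (m≡m%n+[m/n]*n m 2) ⟩
    -1ℤ ^ (m % 2 ℕ.+ m / 2 ℕ.* 2)        ≡⟨ ℤP.^-distribˡ-+-* -1ℤ (m % 2) _ ⟩
    -1ℤ ^ (m % 2) * -1ℤ ^ (m / 2 ℕ.* 2)  ≡⟨ cong₂ _*_ (cong (-1ℤ ^_) m%2≡1) (-1^-even (divides (m / 2) refl)) ⟩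
    -1ℤ                                  ∎
    where
    m%2≡1 : m % 2 ≡ 1
    m%2≡1 with m % 2 in eq | m%n<n m 2
    ... | 0           | _ = ⊥-elim (¬2∣m (m%n≡0⇒n∣m m 2 eq))
    ... | 1           | _ = refl
    ... | suc (suc r) | ℕ.s≤s (ℕ.s≤s ())

  prodℤ-cong : ∀ m {f g : Fin m → ℤ} → (∀ i → f i ≡ g i) → prodℤ m f ≡ prodℤ m g
  prodℤ-cong zero    eq = refl
  prodℤ-cong (suc m) eq = cong₂ _*_ (eq zero) (prodℤ-cong m (eq ∘ suc))

  prodℤ-zero : ∀ m (f : Fin m → ℤ) i → f i ≡ 0ℤ → prodℤ m f ≡ 0ℤ
  prodℤ-zero (suc m) f zero    eq = cong (_* prodℤ m (f ∘ suc)) eq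
  prodℤ-zero (suc m) f (suc i) eq =
    trans (cong (f zero *_) (prodℤ-zero m (f ∘ suc) i eq)) (ℤP.*-zeroʳ (f zero))

  prodℤ-one : ∀ m (f : Fin m → ℤ) → (∀ i → f i ≡ 1ℤ) → prodℤ m f ≡ 1ℤ
  prodℤ-one zero    f eq = refl
  prodℤ-one (suc m) f eq = cong₂ _*_ (eq zero) (prodℤ-one m (f ∘ suc) (eq ∘ suc))

  prodℤ-signs : ∀ m (f g : Fin m → ℤ) (e : Fin m → ℕ) →
    (∀ i → g i ≡ -1ℤ ^ e i * f i) → prodℤ m g ≡ -1ℤ ^ sumℕ m e * prodℤ m f
  prodℤ-signs zero    f g e eq = refl
  prodℤ-signs (suc m) f g e eq = begin
    g zero * prodℤ m (g ∘ suc)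
      ≡⟨ cong₂ _*_ (eq zero) (prodℤ-signs m (f ∘ suc) (g ∘ suc) (e ∘ suc) (eq ∘ suc)) ⟩
    (-1ℤ ^ e zero * f zero) * (-1ℤ ^ sumℕ m (e ∘ suc) * prodℤ m (f ∘ suc))
      ≡⟨ interchange (-1ℤ ^ e zero) (f zero) (-1ℤ ^ sumℕ m (e ∘ suc)) (prodℤ m (f ∘ suc)) ⟩
    (-1ℤ ^ e zero * -1ℤ ^ sumℕ m (e ∘ suc)) * prodℤ (suc m) f
      ≡⟨ cong (_* prodℤ (suc m) f) (sym (ℤP.^-distribˡ-+-* -1ℤ (e zero) _)) ⟩
    -1ℤ ^ sumℕ (suc m) e * prodℤ (suc m) f
      ∎

  prodℤ-negate : ∀ m (f g : Fin m → ℤ) (c : Fin m → Bool) →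
    (∀ i → g i ≡ (if c i then - f i else f i)) → prodℤ m g ≡ -1ℤ ^ countFin m c * prodℤ m f
  prodℤ-negate m f g c eq = trans
    (prodℤ-signs m f g (ind ∘ c) (λ i → trans (eq i) (negate-as-sign (c i))))
    (cong (λ s → -1ℤ ^ s * prodℤ m f) (sym (countFin≡sumℕ m c)))
    where
    negate-as-sign : ∀ β {x} → (if β then - x else x) ≡ -1ℤ ^ ind β * x
    negate-as-sign true  {x} = sym (ℤP.-1*i≡-i x)
    negate-as-sign false {x} = sym (ℤP.*-identityˡ x)

module IntegerSums where
  open IteratedSums
  import Data.Integer.Properties as ℤP
  open import Algebra.Properties.CommutativeSemigroup ℤP.+-commutativeSemigroup
    using (interchange)
  open import Data.Bool.Base using (true; false)
  open import Data.Fin.Base using (zero; suc)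
  open import Data.Integer.Base using (ℤ; +_; 0ℤ; _+_; _*_)
  open import Data.Nat.Base as ℕ using (ℕ; zero; suc; _^_)
  open import Function.Base using (_∘_)
  open import Relation.Binary.PropositionalEquality
  open ≡-Reasoning

  sumBoolℤ-isSum : IsSum _+_ _*_ 0ℤ sumBoolℤ
  sumBoolℤ-isSum = record
    { cong-S = λ eq → cong₂ _+_ (eq true) (eq false)
    ; +-hom  = λ g h → interchange (g true) (h true) (g false) (h false)
    ; *-hom  = λ c g → sym (ℤP.*-distribˡ-+ c (g true) (g false))
    ; 0-hom  = refl }

  sumℤ-isSum : ∀ n → IsSum _+_ _*_ 0ℤ (sumℤ n)
  sumℤ-isSum n = record { cong-S = cong-sum n ; +-hom = additive n ; *-hom = homogeneous n ; 0-hom = zero-sum n }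
    where
    cong-sum : ∀ n → Congruent (sumℤ n)
    cong-sum zero    eq = refl
    cong-sum (suc n) eq = cong₂ _+_ (eq zero) (cong-sum n (eq ∘ suc))
    additive : ∀ n g h → sumℤ n (λ x → g x + h x) ≡ sumℤ n g + sumℤ n h
    additive zero    g h = refl
    additive (suc n) g h = trans (cong (_+_ (g zero + h zero)) (additive n (g ∘ suc) (h ∘ suc)))
                                 (interchange (g zero) (h zero) _ _)
    homogeneous : ∀ n c g → sumℤ n (λ x → c * g x) ≡ c * sumℤ n g
    homogeneous zero    c g = sym (ℤP.*-zeroʳ c)
    homogeneous (suc n) c g = trans (cong (_+_ (c * g zero)) (homogeneous n c (g ∘ suc)))
                                    (sym (ℤP.*-distribˡ-+ c _ _))
    zero-sum : ∀ n → sumℤ n (λ _ → 0ℤ) ≡ 0ℤ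
    zero-sum zero    = refl
    zero-sum (suc n) = trans (ℤP.+-identityˡ _) (zero-sum n)

  sumBoolℤ-commute : ∀ {C} {T : (C → ℤ) → ℤ} → IsSum _+_ _*_ 0ℤ T → Commute sumBoolℤ T
  sumBoolℤ-commute isSum H = sym (IsSum.+-hom isSum (H true) (H false))

  sumMapsℤ-const : ∀ {B} {S : (B → ℤ) → ℤ} (k : ℕ) → (∀ c → S (λ _ → c) ≡ + k * c) →
    ∀ m c → sumMaps S m (λ _ → c) ≡ + (k ^ m) * c
  sumMapsℤ-const k const zero    c = sym (ℤP.*-identityˡ c)
  sumMapsℤ-const {S = S} k const (suc m) c = begin
    S (λ _ → sumMaps S m (λ _ → c))  ≡⟨ const _ ⟩
    + k * sumMaps S m (λ _ → c)      ≡⟨ cong (+ k *_) (sumMapsℤ-const k const m c) ⟩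
    + k * (+ (k ^ m) * c)            ≡⟨ sym (ℤP.*-assoc (+ k) _ c) ⟩
    (+ k * + (k ^ m)) * c            ≡⟨ cong (_* c) (sym (ℤP.pos-* k (k ^ m))) ⟩
    + (k ^ suc m) * c                ∎

module BitArrays where
  open IteratedSums
  open IntegerSums
  open import Data.Bool.Base using (true; false; not)
  open import Data.Fin.Base using (Fin)
  open import Data.Fin.Properties using (_≟_)
  open import Data.Integer.Base using (ℤ; +_; 0ℤ; _+_; _*_)
  import Data.Integer.Properties as ℤP
  open import Data.Nat.Base as ℕ using (ℕ; _^_)
  open import Data.Nat.Properties using (^-*-assoc)
  open import Data.Product using (_×_; _,_)
  open import Data.Unit.Base using (⊤)
  open import Function.Base using (_∘_)
  open import Relation.Binary.PropositionalEquality
  open import Relation.Nullary using (yes; no; ¬_)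

  private
    variable
      n : ℕ
      a c x y : Fin n

  flipBit : Fin n → Fin n → Bits n → Bits n
  flipBit x y = flipAt x (flipAt y not)

  flipBit-same : (b : Bits n) → flipBit x y b x y ≡ not (b x y)
  flipBit-same {x = x} {y} b =
    trans (cong (λ row → row y) (flipAt-same x (flipAt y not) b)) (flipAt-same y not (b x))

  flipBit-other : (b : Bits n) → ¬ (a ≡ x × c ≡ y) → flipBit x y b a c ≡ b a c
  flipBit-other {a = a} {x} {c} {y} b ¬hit with a ≟ x
  ... | no a≢x   = cong (λ row → row c) (flipAt-other (flipAt y not) b a≢x)
  ... | yes refl = trans (cong (λ row → row c) (flipAt-same a (flipAt y not) b))
                         (flipAt-other not (b a) (λ c≡y → ¬hit (refl , c≡y)))

  bits-constant : ∀ {A : Set} (F : Bits n → A) → (∀ b b′ → (∀ a c → b a c ≡ b′ a c) → F b ≡ F b′) →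
    (∀ x y b → F (flipBit x y b) ≡ F b) → ∀ b b′ → F b ≡ F b′
  bits-constant {n = n} {A} F resp inv =
    flip-invariant⇒constant _≗_ (λ _ → refl) (λ y → flipAt y not) rowsConnected n F resp inv
    where
    bitConnected : ConnectedBy _≡_ refl (λ (_ : ⊤) → not) A
    bitConnected G _ inv true  true  = refl
    bitConnected G _ inv true  false = sym (inv _ true)
    bitConnected G _ inv false true  = sym (inv _ false)
    bitConnected G _ inv false false = refl
    rowsConnected : ConnectedBy _≗_ (λ _ → refl) (λ y → flipAt y not) A
    rowsConnected G resp inv =
      flip-invariant⇒constant _≡_ refl (λ _ → not) bitConnected n G resp (λ i _ → inv i)

  sumBitsℤ : (Bits n → ℤ) → ℤ
  sumBitsℤ {n} = sumMaps (sumMaps sumBoolℤ n) n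

  sumBitsℤ-isSum : IsSum _+_ _*_ 0ℤ (sumBitsℤ {n})
  sumBitsℤ-isSum {n} = sumMaps-isSum (sumMaps-isSum sumBoolℤ-isSum n) n

  sumBitsℤ-flip : ∀ (x y : Fin n) F → sumBitsℤ (F ∘ flipBit x y) ≡ sumBitsℤ F
  sumBitsℤ-flip {n} x y = sumMaps-flip (IsSum.cong-S (sumMaps-isSum sumBoolℤ-isSum n))
    (sumMaps-flip (IsSum.cong-S sumBoolℤ-isSum) (λ h → ℤP.+-comm (h false) (h true)) n y) n x

  sumBitsℤ-const : ∀ c → sumBitsℤ {n} (λ _ → c) ≡ + (2 ^ (n ℕ.* n)) * c
  sumBitsℤ-const {n} c = trans (sumMapsℤ-const (2 ^ n) (sumMapsℤ-const 2 bool-const n) n c)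
                               (cong (λ k → + k * c) (^-*-assoc 2 n n))
    where
    bool-const : ∀ c → sumBoolℤ (λ _ → c) ≡ + 2 * c
    bool-const c = sym (trans (ℤP.*-distribʳ-+ c (+ 1) (+ 1))
                              (cong₂ _+_ (ℤP.*-identityˡ c) (ℤP.*-identityˡ c)))

module EdgeWeights where
  open BitArrays using (flipBit; flipBit-same; flipBit-other)
  open Decisions
  open import Data.Bool.Base using (Bool; true; false; not; T; if_then_else_; _∧_; _∨_)
  open import Data.Empty using (⊥-elim)
  open import Data.Fin.Base using (Fin; toℕ)
  open import Data.Fin.Properties using (_≟_; toℕ-injective)
  open import Data.Integer.Base using (0ℤ; 1ℤ; -_)
  open import Data.Nat.Base using (ℕ; _<_; _<ᵇ_)
  open import Data.Nat.Properties using (<⇒<ᵇ; <ᵇ⇒<; <-irrefl; <-asym; <-cmp)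
  open import Data.Product using (_×_; _,_; swap)
  open import Data.Sum using (_⊎_; inj₁; inj₂)
  open import Data.Unit.Base using (tt)
  open import Function.Base using (_∘_)
  open import Relation.Binary.Definitions using (tri<; tri≈; tri>)
  open import Relation.Binary.PropositionalEquality
  open import Relation.Nullary using (Dec; yes; no; _×-dec_; _⊎-dec_)
  open import Relation.Nullary.Decidable using (⌊_⌋; isYes≗does)

  private
    variable
      n : ℕ
      a c x y : Fin n

  sgn-not : ∀ β → sgn (not β) ≡ - sgn β
  sgn-not true  = refl
  sgn-not false = refl

  weight-diag : (b : Bits n) (a : Fin n) → weight b a a ≡ 0ℤ
  weight-diag b a rewrite isYes-true (a ≟ a) refl = refl

  weight-below : (b : Bits n) → toℕ a < toℕ c → weight b a c ≡ sgn (b a c)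
  weight-below {a = a} {c} b a<c
    rewrite isYes-false (a ≟ c) (λ a≡c → <-irrefl (cong toℕ a≡c) a<c)
    with toℕ a <ᵇ toℕ c | <⇒<ᵇ a<c
  ... | true | _ = refl

  weight-above : (b : Bits n) → toℕ c < toℕ a → weight b a c ≡ sgn (b c a)
  weight-above {c = c} {a} b c<a
    rewrite isYes-false (a ≟ c) (λ a≡c → <-irrefl (cong toℕ (sym a≡c)) c<a)
    with toℕ a <ᵇ toℕ c in a<ᵇc
  ... | true  = ⊥-elim (<-asym c<a (<ᵇ⇒< (toℕ a) (toℕ c) (subst T (sym a<ᵇc) tt)))
  ... | false = refl

  weight-cong : (b b′ : Bits n) → b a c ≡ b′ a c → b c a ≡ b′ c a → weight b a c ≡ weight b′ a c
  weight-cong {a = a} {c} b b′ = cong₂ (λ p q →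
    if ⌊ a ≟ c ⌋ then 0ℤ else (if toℕ a <ᵇ toℕ c then sgn p else sgn q))

  weight-upper : (b b′ : Bits n) → (∀ a c → toℕ a < toℕ c → b a c ≡ b′ a c) →
    ∀ a c → weight b a c ≡ weight b′ a c
  weight-upper b b′ agree a c with <-cmp (toℕ a) (toℕ c)
  ... | tri< a<c _ _ = trans (weight-below b a<c)
                             (trans (cong sgn (agree a c a<c)) (sym (weight-below b′ a<c)))
  ... | tri> _ _ c<a = trans (weight-above b c<a)
                             (trans (cong sgn (agree c a c<a)) (sym (weight-above b′ c<a)))
  ... | tri≈ _ a≡c _ rewrite toℕ-injective a≡c = trans (weight-diag b c) (sym (weight-diag b′ c))

  weight-allTrue : a ≢ c → weight (λ _ _ → true) a c ≡ 1ℤ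
  weight-allTrue {a = a} {c} a≢c with <-cmp (toℕ a) (toℕ c)
  ... | tri< a<c _ _ = weight-below _ a<c
  ... | tri> _ _ c<a = weight-above _ c<a
  ... | tri≈ _ a≡c _ = ⊥-elim (a≢c (toℕ-injective a≡c))

  hits : (x y a c : Fin n) → Bool
  hits x y a c = (⌊ a ≟ x ⌋ ∧ ⌊ c ≟ y ⌋) ∨ (⌊ a ≟ y ⌋ ∧ ⌊ c ≟ x ⌋)

  pairHit? : (x y a c : Fin n) → Dec ((a ≡ x × c ≡ y) ⊎ (a ≡ y × c ≡ x))
  pairHit? x y a c = (a ≟ x ×-dec c ≟ y) ⊎-dec (a ≟ y ×-dec c ≟ x)

  hits≡pairHit? : (x y a c : Fin n) → hits x y a c ≡ ⌊ pairHit? x y a c ⌋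
  hits≡pairHit? x y a c = trans
    (cong₂ _∨_ (cong₂ _∧_ (isYes≗does (a ≟ x)) (isYes≗does (c ≟ y)))
               (cong₂ _∧_ (isYes≗does (a ≟ y)) (isYes≗does (c ≟ x))))
    (sym (isYes≗does (pairHit? x y a c)))

  weight-flipBit : toℕ x < toℕ y → ∀ (b : Bits n) a c →
    weight (flipBit x y b) a c ≡ (if hits x y a c then - weight b a c else weight b a c)
  weight-flipBit {x = x} {y} x<y b a c rewrite hits≡pairHit? x y a c with pairHit? x y a c
  ... | yes (inj₁ (refl , refl)) = trans (weight-below (flipBit a c b) x<y)
    (trans (cong sgn (flipBit-same b)) (trans (sgn-not (b a c)) (cong -_ (sym (weight-below b x<y)))))
  ... | yes (inj₂ (refl , refl)) = trans (weight-above (flipBit c a b) x<y)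
    (trans (cong sgn (flipBit-same b)) (trans (sgn-not (b c a)) (cong -_ (sym (weight-above b x<y)))))
  ... | no ¬hit = weight-cong (flipBit x y b) b
    (flipBit-other b (¬hit ∘ inj₁)) (flipBit-other b (¬hit ∘ inj₂ ∘ swap))

module EdgeProduct (G : Graph) where
  open IteratedSums
  open Decisions
  open Signs
  open IntegerSums
  open BitArrays
  open EdgeWeights
  open NatSums using (sumℕ-isSum; countFin-cong)
  open import Data.Bool.Base using (Bool; true; false; if_then_else_; _∧_)
  import Data.Bool.Properties as BoolP
  open import Data.Empty using (⊥-elim)
  open import Data.Fin.Base using (Fin; toℕ)
  open import Data.Fin.Properties using (_≟_; any?; toℕ-injective)
  open import Data.Integer.Base using (ℤ; +_; 0ℤ; 1ℤ; -1ℤ; _*_; -_; _^_)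
  import Data.Integer.Properties as ℤP
  open import Data.Nat.Base as ℕ using (ℕ; zero; _<_; _<ᵇ_)
  open import Data.Nat.Divisibility using (_∣_; _∣?_)
  open import Data.Nat.Properties using (<⇒<ᵇ; <-irrefl; <-cmp)
  open import Data.Product using (∃₂; _×_; _,_)
  open import Data.Sum using (_⊎_; inj₁; inj₂)
  open import Function.Bundles using (_⇔_; mk⇔; module Equivalence)
  open import Relation.Binary.Definitions using (tri<; tri≈; tri>)
  open import Relation.Binary.PropositionalEquality
  open import Relation.Nullary using (Dec; yes; no; ¬_; ¬?; _×-dec_; _⊎-dec_)
  open import Relation.Nullary.Decidable using (⌊_⌋; decidable-stable)
  import Relation.Nullary.Decidable as Dec
  open ≡-Reasoning

  private
    K : ℕ
    K = k G
    variable
      n : ℕ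
      φ : Fin K → Fin n
      b : Bits n
      u v : Fin K

  edgeFactor : (Fin K → Fin n) → Bits n → Fin K → Fin K → ℤ
  edgeFactor φ b u v = if isEdge G u v then weight b (φ u) (φ v) else 1ℤ

  edgeProduct : (Fin K → Fin n) → Bits n → ℤ
  edgeProduct φ b = prodℤ K (λ u → prodℤ K (edgeFactor φ b u))

  edgeProduct-upper : ∀ {b b′ : Bits n} → (∀ a c → toℕ a < toℕ c → b a c ≡ b′ a c) →
    edgeProduct φ b ≡ edgeProduct φ b′
  edgeProduct-upper {φ = φ} agree = prodℤ-cong K (λ u → prodℤ-cong K (λ v →
    cong (λ w → if isEdge G u v then w else 1ℤ) (weight-upper _ _ agree (φ u) (φ v))))

  edgeProduct-cong : ∀ {ψ : Fin K → Fin n} → φ ≗ ψ → edgeProduct φ b ≡ edgeProduct ψ b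
  edgeProduct-cong {b = b} eq = prodℤ-cong K (λ u → prodℤ-cong K (λ v →
    cong (λ w → if isEdge G u v then w else 1ℤ) (cong₂ (weight b) (eq u) (eq v))))

  isEdge-below : toℕ u < toℕ v → adj G u v ≡ true → isEdge G u v ≡ true
  isEdge-below {u} {v} u<v uv with toℕ u <ᵇ toℕ v | <⇒<ᵇ u<v
  ... | true | _ = uv

  isEdge⇒adj : isEdge G u v ≡ true → adj G u v ≡ true
  isEdge⇒adj {u} {v} e with toℕ u <ᵇ toℕ v
  ... | true = e

  adj-irreflexive : adj G u v ≡ true → u ≢ v
  adj-irreflexive {u} uv refl with trans (sym uv) (irrefl G u)
  ... | ()

  -- An edge mapped to a single vertex (a loop of K_n, weight 0) kills the product.
  edgeProduct-clash-below : toℕ u < toℕ v → adj G u v ≡ true → φ u ≡ φ v → edgeProduct φ b ≡ 0ℤ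
  edgeProduct-clash-below {u} {v} {φ = φ} {b = b} u<v uv φu≡φv =
    prodℤ-zero K _ u (prodℤ-zero K _ v factor≡0)
    where
    factor≡0 : edgeFactor φ b u v ≡ 0ℤ
    factor≡0 rewrite isEdge-below u<v uv | φu≡φv = weight-diag b (φ v)

  edgeProduct-clash : adj G u v ≡ true → φ u ≡ φ v → edgeProduct φ b ≡ 0ℤ
  edgeProduct-clash {u} {v} {b = b} uv φu≡φv with <-cmp (toℕ u) (toℕ v)
  ... | tri< u<v _ _ = edgeProduct-clash-below {b = b} u<v uv φu≡φv
  ... | tri> _ _ v<u = edgeProduct-clash-below {b = b} v<u (trans (Graph.sym G v u) uv) (sym φu≡φv)
  ... | tri≈ _ u≡v _ = ⊥-elim (adj-irreflexive uv (toℕ-injective u≡v))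

  edgeProduct-allTrue : IsHom G n φ → edgeProduct φ (λ _ _ → true) ≡ 1ℤ
  edgeProduct-allTrue {φ = φ} hom = prodℤ-one K _ (λ u → prodℤ-one K _ (factor≡1 u))
    where
    factor≡1 : ∀ u v → edgeFactor φ (λ _ _ → true) u v ≡ 1ℤ
    factor≡1 u v with isEdge G u v in e
    ... | true  = weight-allTrue (hom u v (isEdge⇒adj e))
    ... | false = refl

  edgeProduct-flipBit : ∀ {x y : Fin n} → toℕ x < toℕ y → ∀ b →
    edgeProduct φ (flipBit x y b) ≡ -1ℤ ^ edgeMult G n φ x y * edgeProduct φ b
  edgeProduct-flipBit {φ = φ} {x} {y} x<y b =
    prodℤ-signs K (λ u → prodℤ K (edgeFactor φ b u)) (λ u → prodℤ K (edgeFactor φ (flipBit x y b) u))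
      (λ u → countFin K (hit u))
      (λ u → prodℤ-negate K (edgeFactor φ b u) (edgeFactor φ (flipBit x y b) u) (hit u) (factor-flip u))
    where
    hit : Fin K → Fin K → Bool
    hit u v = isEdge G u v ∧ hits x y (φ u) (φ v)
    factor-flip : ∀ u v → edgeFactor φ (flipBit x y b) u v ≡
      (if hit u v then - edgeFactor φ b u v else edgeFactor φ b u v)
    factor-flip u v with isEdge G u v
    ... | true  = weight-flipBit x<y b (φ u) (φ v)
    ... | false = refl

  edgeProduct-even : IsEvenHom G n φ → ∀ b → edgeProduct φ b ≡ 1ℤ
  edgeProduct-even {φ = φ} (hom , even) b = trans
    (bits-constant (edgeProduct φ) (λ _ _ eq → edgeProduct-upper {φ = φ} (λ a c _ → eq a c))
                   flip-invariant b (λ _ _ → true))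
    (edgeProduct-allTrue hom)
    where
    -- Bits on or below the diagonal are never read.
    off-diagonal : ∀ {x y} → ¬ toℕ x < toℕ y → ∀ b → edgeProduct φ (flipBit x y b) ≡ edgeProduct φ b
    off-diagonal {x} {y} ¬x<y b = edgeProduct-upper {φ = φ} (λ a c a<c →
      flipBit-other {x = x} {y = y} b (λ { (refl , refl) → ¬x<y a<c }))
    -- Above the diagonal a flip multiplies by (-1)^(even multiplicity) = 1.
    flip-invariant : ∀ x y b → edgeProduct φ (flipBit x y b) ≡ edgeProduct φ b
    flip-invariant x y b with <-cmp (toℕ x) (toℕ y)
    ... | tri< x<y _ _ = begin
      edgeProduct φ (flipBit x y b)                       ≡⟨ edgeProduct-flipBit {φ = φ} x<y b ⟩
      -1ℤ ^ edgeMult G _ φ x y * edgeProduct φ b         ≡⟨ cong (_* edgeProduct φ b) (-1^-even (even x y x≢y)) ⟩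
      1ℤ * edgeProduct φ b                                ≡⟨ ℤP.*-identityˡ _ ⟩
      edgeProduct φ b                                     ∎
      where
      x≢y : x ≢ y
      x≢y x≡y = <-irrefl (cong toℕ x≡y) x<y
    ... | tri≈ ¬x<y _ _ = off-diagonal ¬x<y b
    ... | tri> ¬x<y _ _ = off-diagonal ¬x<y b

  Clash : (Fin K → Fin n) → Set
  Clash φ = ∃₂ λ u v → adj G u v ≡ true × φ u ≡ φ v

  OddPair : (Fin K → Fin n) → Set
  OddPair {n} φ = ∃₂ λ x y → x ≢ y × ¬ 2 ∣ edgeMult G n φ x y

  clash? : (φ : Fin K → Fin n) → Dec (Clash φ)
  clash? φ = any? λ u → any? λ v → (adj G u v BoolP.≟ true) ×-dec (φ u ≟ φ v)

  oddPair? : (φ : Fin K → Fin n) → Dec (OddPair φ)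
  oddPair? {n} φ = any? λ x → any? λ y → ¬? (x ≟ y) ×-dec ¬? (2 ∣? edgeMult G n φ x y)

  unobstructed⇔evenHom : (¬ (Clash φ ⊎ OddPair φ)) ⇔ IsEvenHom G n φ
  unobstructed⇔evenHom = mk⇔
    (λ ¬obs → (λ u v uv eq → ¬obs (inj₁ (u , v , uv , eq))) ,
              (λ x y x≢y → decidable-stable (2 ∣? _) (λ odd → ¬obs (inj₂ (x , y , x≢y , odd)))))
    (λ { (hom , even) (inj₁ (u , v , uv , eq))  → hom u v uv eq
       ; (hom , even) (inj₂ (x , y , x≢y , odd)) → odd (even x y x≢y) })

  evenHom? : (φ : Fin K → Fin n) → Dec (IsEvenHom G n φ)
  evenHom? φ = Dec.map unobstructed⇔evenHom (¬? (clash? φ ⊎-dec oddPair? φ))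

  obstruction : ¬ IsEvenHom G n φ → Clash φ ⊎ OddPair φ
  obstruction {φ = φ} ¬ev =
    decidable-stable (clash? φ ⊎-dec oddPair? φ) (λ ¬obs → ¬ev (Equivalence.to unobstructed⇔evenHom ¬obs))

  edgeMult-sym : ∀ {x y : Fin n} → edgeMult G n φ x y ≡ edgeMult G n φ y x
  edgeMult-sym {φ = φ} {x} {y} = IsSum.cong-S (sumℕ-isSum K) (λ u → countFin-cong K (λ v →
    cong (isEdge G u v ∧_) (BoolP.∨-comm (⌊ φ u ≟ x ⌋ ∧ ⌊ φ v ≟ y ⌋) (⌊ φ u ≟ y ⌋ ∧ ⌊ φ v ≟ x ⌋))))

  self-negating : ∀ {i : ℤ} → i ≡ - i → i ≡ 0ℤ
  self-negating {+ zero} _ = refl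

  -- An odd pair makes the sum over all weights vanish: flipping its bit is a
  -- bijection of Bits n that negates the edge product.
  sumBits-odd : ∀ {x y : Fin n} → toℕ x < toℕ y → ¬ 2 ∣ edgeMult G n φ x y →
    sumBitsℤ (edgeProduct φ) ≡ 0ℤ
  sumBits-odd {φ = φ} {x} {y} x<y odd = self-negating (begin
    sumBitsℤ (edgeProduct φ)                              ≡⟨ sym (sumBitsℤ-flip x y (edgeProduct φ)) ⟩
    sumBitsℤ (λ b → edgeProduct φ (flipBit x y b))        ≡⟨ cong-S (λ b → edgeProduct-flipBit {φ = φ} x<y b) ⟩
    sumBitsℤ (λ b → s * edgeProduct φ b)                  ≡⟨ *-hom s (edgeProduct φ) ⟩
    s * sumBitsℤ (edgeProduct φ)                          ≡⟨ cong (_* sumBitsℤ (edgeProduct φ)) (-1^-odd odd) ⟩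
    -1ℤ * sumBitsℤ (edgeProduct φ)                        ≡⟨ ℤP.-1*i≡-i _ ⟩
    - sumBitsℤ (edgeProduct φ)                            ∎)
    where
    open IsSum sumBitsℤ-isSum
    s : ℤ
    s = -1ℤ ^ edgeMult G _ φ x y

  sumBits-oddPair : OddPair φ → sumBitsℤ (edgeProduct φ) ≡ 0ℤ
  sumBits-oddPair {φ = φ} (x , y , x≢y , odd) with <-cmp (toℕ x) (toℕ y)
  ... | tri< x<y _ _ = sumBits-odd {φ = φ} x<y odd
  ... | tri> _ _ y<x = sumBits-odd {φ = φ} y<x (λ even → odd (subst (2 ∣_) (edgeMult-sym {φ = φ}) even))
  ... | tri≈ _ x≡y _ = ⊥-elim (x≢y (toℕ-injective x≡y))

  sumBits-edgeProduct : (φ : Fin K → Fin n) →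
    sumBitsℤ (edgeProduct φ) ≡ + (2 ℕ.^ (n ℕ.* n)) * + ind ⌊ evenHom? φ ⌋
  sumBits-edgeProduct {n} φ with evenHom? φ
  ... | yes ev = trans (cong-S (edgeProduct-even ev)) (sumBitsℤ-const {n} 1ℤ)
    where open IsSum (sumBitsℤ-isSum {n})
  ... | no ¬ev = trans vanish (sym (ℤP.*-zeroʳ (+ (2 ℕ.^ (n ℕ.* n)))))
    where
    open IsSum (sumBitsℤ-isSum {n})
    vanish : sumBitsℤ (edgeProduct φ) ≡ 0ℤ
    vanish with obstruction ¬ev
    ... | inj₁ (u , v , uv , eq) = trans (cong-S (λ b → edgeProduct-clash {b = b} uv eq)) 0-hom
    ... | inj₂ oddPair           = sumBits-oddPair {φ = φ} oddPair

module Fractions where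
  open import Data.Integer.Base as ℤ using (ℤ; +_)
  open import Data.Integer.Tactic.RingSolver using (solve-∀)
  import Data.Integer.Properties as ℤP
  open import Data.Nat.Base as ℕ using (ℕ; suc; NonZero)
  open import Data.Nat.Properties using (m*n≢0; *-identityˡ)
  open import Data.Rational.Base as ℚ using (ℚ; _/_; toℚᵘ)
  import Data.Rational.Properties as ℚP
  open import Data.Rational.Unnormalised.Base as ℚᵘ using (mkℚᵘ; *≡*; *≤*; *<*)
  import Data.Rational.Unnormalised.Properties as ℚᵘP
  open import Relation.Binary.PropositionalEquality

  toℚᵘ-/ : ∀ i d → toℚᵘ (i / suc d) ℚᵘ.≃ mkℚᵘ i d
  toℚᵘ-/ i d = ℚP.toℚᵘ-fromℚᵘ (mkℚᵘ i d)

  /-≡ : ∀ a b A B .{{_ : NonZero A}} .{{_ : NonZero B}} → a ℤ.* + B ≡ b ℤ.* + A → a / A ≡ b / B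
  /-≡ a b (suc A) (suc B) eq = ℚP.toℚᵘ-injective
    (ℚᵘP.≃-trans (toℚᵘ-/ a A) (ℚᵘP.≃-trans (*≡* eq) (ℚᵘP.≃-sym (toℚᵘ-/ b B))))

  /-≤ : ∀ a b A B .{{_ : NonZero A}} .{{_ : NonZero B}} → a ℤ.* + B ℤ.≤ b ℤ.* + A → a / A ℚ.≤ b / B
  /-≤ a b (suc A) (suc B) le = ℚP.toℚᵘ-cancel-≤
    (ℚᵘP.≤-respˡ-≃ (ℚᵘP.≃-sym (toℚᵘ-/ a A)) (ℚᵘP.≤-respʳ-≃ (ℚᵘP.≃-sym (toℚᵘ-/ b B)) (*≤* le)))

  /-< : ∀ a b A B .{{_ : NonZero A}} .{{_ : NonZero B}} → a ℤ.* + B ℤ.< b ℤ.* + A → a / A ℚ.< b / B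
  /-< a b (suc A) (suc B) lt = ℚP.toℚᵘ-cancel-<
    (ℚᵘP.<-respˡ-≃ (ℚᵘP.≃-sym (toℚᵘ-/ a A)) (ℚᵘP.<-respʳ-≃ (ℚᵘP.≃-sym (toℚᵘ-/ b B)) (*<* lt)))

  /-* : ∀ a b A B .{{_ : NonZero A}} .{{_ : NonZero B}} →
    (a / A) ℚ.* (b / B) ≡ ((a ℤ.* b) / (A ℕ.* B)) {{m*n≢0 A B}}
  /-* a b (suc A) (suc B) = ℚP.toℚᵘ-injective (ℚᵘP.≃-trans (ℚP.toℚᵘ-homo-* (a / suc A) (b / suc B))
    (ℚᵘP.≃-trans (ℚᵘP.*-cong (toℚᵘ-/ a A) (toℚᵘ-/ b B)) (ℚᵘP.≃-sym (toℚᵘ-/ (a ℤ.* b) _))))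

  /1-* : ∀ c d .{{_ : NonZero d}} → (c / 1) ℚ.* (+ 1 / d) ≡ c / d
  /1-* c d = trans (/-* c (+ 1) 1 d) (/-≡ (c ℤ.* + 1) c (1 ℕ.* d) d {{m*n≢0 1 d}} cross)
    where
    cross : (c ℤ.* + 1) ℤ.* + d ≡ c ℤ.* + (1 ℕ.* d)
    cross rewrite ℤP.*-identityʳ c | *-identityˡ d = refl

  positive-/ : ∀ c d .{{_ : NonZero d}} → 0 ℕ.< c → ℚ.0ℚ ℚ.< + c / d
  positive-/ c d 0<c = subst (ℚ._< + c / d) (ℚP.0/n≡0 1)
    (/-< (+ 0) (+ c) 1 d (subst (+ 0 ℤ.<_) (sym (ℤP.*-identityʳ (+ c))) (ℤ.+<+ 0<c)))

  pos-*-mono : ∀ a b c d → a ℕ.* b ℕ.≤ c ℕ.* d → + a ℤ.* + b ℤ.≤ + c ℤ.* + d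
  pos-*-mono a b c d le = subst₂ ℤ._≤_ (ℤP.pos-* a b) (ℤP.pos-* c d) (ℤ.+≤+ le)

  /-+ : ∀ a b N .{{_ : NonZero N}} → (a / N) ℚ.+ (b / N) ≡ (a ℤ.+ b) / N
  /-+ a b (suc N) = ℚP.toℚᵘ-injective (ℚᵘP.≃-trans (ℚP.toℚᵘ-homo-+ (a / suc N) (b / suc N))
    (ℚᵘP.≃-trans (ℚᵘP.+-cong (toℚᵘ-/ a N) (toℚᵘ-/ b N))
      (ℚᵘP.≃-trans (*≡* cross) (ℚᵘP.≃-sym (toℚᵘ-/ (a ℤ.+ b) N)))))
    where
    cross : (a ℤ.* + suc N ℤ.+ b ℤ.* + suc N) ℤ.* + suc N ≡ (a ℤ.+ b) ℤ.* + (suc N ℕ.* suc N)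
    cross rewrite ℤP.pos-* (suc N) (suc N) = distrib a b (+ suc N)
      where
      distrib : ∀ a b n → (a ℤ.* n ℤ.+ b ℤ.* n) ℤ.* n ≡ (a ℤ.+ b) ℤ.* (n ℤ.* n)
      distrib = solve-∀

module Expectation (G : Graph) where
  open IteratedSums
  open Decisions
  open IntegerSums
  open BitArrays
  open EdgeProduct G
  open Fractions
  open NatSums using (sumℕ-isSum; sumℤ-pos)
  open import Data.Bool.Base using (true; false)
  open import Data.Fin.Base using (Fin)
  open import Data.Integer.Base as ℤ using (ℤ; +_; 1ℤ)
  open import Data.Integer.Tactic.RingSolver using (solve-∀)
  import Data.Integer.Properties as ℤP
  open import Data.Nat.Base as ℕ using (ℕ; NonZero; _^_)
  open import Data.Nat.Properties using (m^n≢0; m*n≢0)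
  open import Data.Rational.Base as ℚ using (ℚ; _/_)
  open import Function.Base using (_∘_)
  open import Relation.Binary.PropositionalEquality
  open import Relation.Nullary.Decidable using (⌊_⌋)
  open ≡-Reasoning

  private
    K : ℕ
    K = k G

  evenHomCount : ℕ → ℕ
  evenHomCount n = sumMaps (sumℕ n) K (λ φ → ind ⌊ evenHom? {n} φ ⌋)

  homSum≡ : ∀ n (b : Bits n) → homSum G n b ≡ sumMaps (sumℤ n) K (λ φ → edgeProduct φ b)
  homSum≡ n b = sumFunℤ≡sumMaps (IsSum.cong-S (sumℤ-isSum n)) K _ (λ _ _ eq → edgeProduct-cong {b = b} eq)

  homSum-cong : ∀ n {b b′ : Bits n} → (∀ x → b x ≗ b′ x) → homSum G n b ≡ homSum G n b′
  homSum-cong n {b} {b′} eq = begin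
    homSum G n b                                     ≡⟨ homSum≡ n b ⟩
    sumMaps (sumℤ n) K (λ φ → edgeProduct φ b)       ≡⟨ sumMaps-cong (IsSum.cong-S (sumℤ-isSum n)) K
                                                          (λ φ → edgeProduct-upper {φ = φ} (λ x y _ → eq x y)) ⟩
    sumMaps (sumℤ n) K (λ φ → edgeProduct φ b′)      ≡⟨ sym (homSum≡ n b′) ⟩
    homSum G n b′                                    ∎

  sumBits-homSum : ∀ n → sumBitsℤ (homSum G n) ≡ + (2 ^ (n ℕ.* n)) ℤ.* + evenHomCount n
  sumBits-homSum n = begin
    sumBitsℤ (homSum G n)
      ≡⟨ IsSum.cong-S sumBitsℤ-isSum (homSum≡ n) ⟩
    sumBitsℤ (λ b → sumφ (λ φ → edgeProduct φ b))
      ≡⟨ sumMaps-commute {T = sumφ} (cong-S outer-isSum)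
           (sumMaps-commute {T = sumφ} (cong-S sumBoolℤ-isSum) (sumBoolℤ-commute sumφ-isSum) n) n
           (λ b φ → edgeProduct φ b) ⟩
    sumφ (λ φ → sumBitsℤ (edgeProduct φ))
      ≡⟨ cong-S sumφ-isSum sumBits-edgeProduct ⟩
    sumφ (λ φ → + (2 ^ (n ℕ.* n)) ℤ.* + ind ⌊ evenHom? φ ⌋)
      ≡⟨ *-hom sumφ-isSum (+ (2 ^ (n ℕ.* n))) (λ φ → + ind ⌊ evenHom? φ ⌋) ⟩
    + (2 ^ (n ℕ.* n)) ℤ.* sumφ (λ φ → + ind ⌊ evenHom? φ ⌋)
      ≡⟨ cong (ℤ._*_ (+ (2 ^ (n ℕ.* n)))) (sumMaps-map +_ (cong-S (sumℤ-isSum n)) (sumℤ-pos n) K _) ⟩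
    + (2 ^ (n ℕ.* n)) ℤ.* + evenHomCount n
      ∎
    where
    open IsSum
    sumφ : ((Fin K → Fin n) → ℤ) → ℤ
    sumφ = sumMaps (sumℤ n) K
    sumφ-isSum : IsSum ℤ._+_ ℤ._*_ (+ 0) sumφ
    sumφ-isSum = sumMaps-isSum (sumℤ-isSum n) K
    outer-isSum : IsSum ℤ._+_ ℤ._*_ (+ 0) (sumMaps sumBoolℤ n)
    outer-isSum = sumMaps-isSum sumBoolℤ-isSum n

  sumFunℚ-t : ∀ n .{{_ : NonZero n}} →
    sumFunℚ (sumFunℚ sumBoolℚ n) n (t G n) ≡ (sumBitsℤ (homSum G n) / n ^ K) {{m^n≢0 n K}}
  sumFunℚ-t n = begin
    sumFunℚ (sumFunℚ sumBoolℚ n) n (t G n)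
      ≡⟨ sumFunℚ≡sumMaps _≗_ (λ _ → refl) (sumFunℚ-cong sumBoolℚ-cong n) (sumMaps-cong sumBoolℚ-cong n)
           (λ g resp → sumFunℚ≡sumMaps _≡_ refl sumBoolℚ-cong sumBoolℚ-cong (λ _ _ → refl) n g resp)
           n (t G n) (λ b b′ eq → cong (_/ N) (homSum-cong n eq)) ⟩
    sumMaps (sumMaps sumBoolℚ n) n ((_/ N) ∘ homSum G n)
      ≡⟨ sumMaps-map (_/ N) (sumMaps-cong sumBoolℚ-cong n)
           (sumMaps-map (_/ N) sumBoolℚ-cong (λ g → /-+ (g true) (g false) N) n) n (homSum G n) ⟩
    sumBitsℤ (homSum G n) / N
      ∎
    where
    N : ℕ
    N = n ^ K
    instance
      N≢0 : NonZero N
      N≢0 = m^n≢0 n K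
    sumBoolℚ-cong : Congruent sumBoolℚ
    sumBoolℚ-cong eq = cong₂ ℚ._+_ (eq true) (eq false)

  expect-t≡ : ∀ n .{{_ : NonZero n}} → expect-t G n ≡ (+ evenHomCount n / n ^ K) {{m^n≢0 n K}}
  expect-t≡ n = begin
    expect-t G n
      ≡⟨ cong (+ 1 / M ℚ.*_) (trans (sumFunℚ-t n) (cong (_/ N) (sumBits-homSum n))) ⟩
    (+ 1 / M) ℚ.* ((+ M ℤ.* + evenHomCount n) / N)
      ≡⟨ /-* (+ 1) (+ M ℤ.* + evenHomCount n) M N ⟩
    ((+ 1 ℤ.* (+ M ℤ.* + evenHomCount n)) / (M ℕ.* N)) {{m*n≢0 M N}}
      ≡⟨ /-≡ (+ 1 ℤ.* (+ M ℤ.* + evenHomCount n)) (+ evenHomCount n) (M ℕ.* N) N {{m*n≢0 M N}}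
             (trans (cancel (+ M) (+ evenHomCount n) (+ N))
                    (cong (ℤ._*_ (+ evenHomCount n)) (sym (ℤP.pos-* M N)))) ⟩
    + evenHomCount n / N
      ∎
    where
    M N : ℕ
    M = 2 ^ (n ℕ.* n)
    N = n ^ K
    instance
      M≢0 : NonZero M
      M≢0 = m^n≢0 2 (n ℕ.* n)
      N≢0 : NonZero N
      N≢0 = m^n≢0 n K
    cancel : ∀ m c n → (1ℤ ℤ.* (m ℤ.* c)) ℤ.* n ≡ c ℤ.* (m ℤ.* n)
    cancel = solve-∀

module Counting where
  open IteratedSums
  open Decisions
  open NatSums
  open import Data.Bool.Base using (Bool; true; false; if_then_else_; _∧_)
  open import Data.Empty using (⊥-elim)
  open import Data.Fin.Base using (Fin; zero; suc)
  open import Data.Fin.Properties using (_≟_)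
  open import Data.Nat.Base using (ℕ; zero; suc; _+_; _*_; _^_; _≤_; z≤n)
  open import Data.Nat.Properties
    using (*-identityʳ; *-comm; *-mono-≤; ≤-refl; ≤-reflexive; ≤-trans; module ≤-Reasoning)
  import Data.Nat.Properties as ℕP
  open import Data.Product using (_×_; _,_)
  open import Function.Base using (_∘_)
  open import Relation.Binary.PropositionalEquality
  open import Relation.Nullary using (Dec; yes; no; does; map′; _×-dec_)
  open import Relation.Nullary.Decidable using (dec-true)

  private
    variable
      m n : ℕ

  countMaps : ∀ n m → ((Fin m → Fin n) → Bool) → ℕ
  countMaps n m P = sumMaps (sumℕ n) m (ind ∘ P)

  sumMapsℕ-isSum : ∀ n m → IsSum _+_ _*_ 0 (sumMaps (sumℕ n) m)
  sumMapsℕ-isSum n = sumMaps-isSum (sumℕ-isSum n)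

  ind-∧ : ∀ β γ → ind (β ∧ γ) ≡ ind β * ind γ
  ind-∧ true  γ = sym (ℕP.+-identityʳ (ind γ))
  ind-∧ false γ = refl

  _≗?_ : (f h : Fin m → Fin n) → Dec (f ≗ h)
  _≗?_ {zero}  f h = yes (λ ())
  _≗?_ {suc m} f h = map′ (λ { (e₀ , e) zero → e₀ ; (e₀ , e) (suc i) → e i }) (λ e → e zero , e ∘ suc)
    (f zero ≟ h zero ×-dec (f ∘ suc) ≗? (h ∘ suc))

  sumℕ-point : ∀ n (a : Fin n) → sumℕ n (λ b → ind (does (b ≟ a))) ≡ 1
  sumℕ-point (suc n) zero    = cong suc (IsSum.0-hom (sumℕ-isSum n))
  sumℕ-point (suc n) (suc a) = sumℕ-point n a

  sumMaps-point : ∀ n m (h : Fin m → Fin n) → sumMaps (sumℕ n) m (λ f → ind (does (f ≗? h))) ≡ 1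
  sumMaps-point n zero    h = refl
  sumMaps-point n (suc m) h = begin
    sumℕ n (λ b → sumMaps (sumℕ n) m (λ φ → ind (does (b ≟ h zero) ∧ does (φ ≗? (h ∘ suc)))))
      ≡⟨ cong-S (sumℕ-isSum n) (λ b →
           trans (cong-S (sumMapsℕ-isSum n m) (λ φ → ind-∧ (does (b ≟ h zero)) (does (φ ≗? (h ∘ suc)))))
                 (*-hom (sumMapsℕ-isSum n m) (ind (does (b ≟ h zero))) (λ φ → ind (does (φ ≗? (h ∘ suc)))))) ⟩
    sumℕ n (λ b → ind (does (b ≟ h zero)) * sumMaps (sumℕ n) m (λ φ → ind (does (φ ≗? (h ∘ suc)))))
      ≡⟨ cong-S (sumℕ-isSum n) (λ b → trans (cong (ind (does (b ≟ h zero)) *_) (sumMaps-point n m (h ∘ suc)))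
                                             (*-identityʳ _)) ⟩
    sumℕ n (λ b → ind (does (b ≟ h zero)))
      ≡⟨ sumℕ-point n (h zero) ⟩
    1 ∎
    where
    open IsSum
    open ≡-Reasoning

  private
    ind-product-≤ : ∀ β γ δ → (β ≡ true → γ ≡ true → δ ≡ true) → ind β * ind γ ≤ ind δ
    ind-product-≤ true  true  δ imp rewrite imp refl refl = ≤-refl
    ind-product-≤ true  false δ imp = z≤n
    ind-product-≤ false γ     δ imp = z≤n

    ind-product≢0 : ∀ β γ → ind β * ind γ ≢ 0 → β ≡ true × γ ≡ true
    ind-product≢0 true  true  _  = refl , refl
    ind-product≢0 true  false ne = ⊥-elim (ne refl)
    ind-product≢0 false γ     ne = ⊥-elim (ne refl)

  -- A map Φ that is injective on the maps satisfying Q and sends them to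
  -- maps satisfying P shows #Q ≤ #P (by double counting the pairs f = Φ g).
  injection-count : ∀ {m m′} (Q : (Fin m → Fin n) → Bool) (P : (Fin m′ → Fin n) → Bool)
    (Φ : (Fin m → Fin n) → (Fin m′ → Fin n)) →
    (∀ g g′ → Q g ≡ true → Q g′ ≡ true → Φ g ≗ Φ g′ → g ≗ g′) →
    (∀ g → Q g ≡ true → P (Φ g) ≡ true) →
    (∀ f f′ → f ≗ f′ → P f ≡ P f′) →
    countMaps n m Q ≤ countMaps n m′ P
  injection-count {n} {m} {m′} Q P Φ injective maps-to respects = begin
    sumMaps (sumℕ n) m (λ g → ind (Q g))
      ≡⟨ cong-S Sg (λ g → sym (trans (*-hom Sf (ind (Q g)) _)
                                      (trans (cong (ind (Q g) *_) (sumMaps-point n m′ (Φ g))) (*-identityʳ _)))) ⟩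
    sumMaps (sumℕ n) m (λ g → sumMaps (sumℕ n) m′ (λ f → pair g f))
      ≡⟨ sumMaps-commute {T = sumMaps (sumℕ n) m′} (cong-S (sumℕ-isSum n)) (sumℕ-commute Sf n) m pair ⟩
    sumMaps (sumℕ n) m′ (λ f → sumMaps (sumℕ n) m (λ g → pair g f))
      ≤⟨ sumMaps-mono {_≤_ = _≤_} (sumℕ-mono n) m′ at-most-one ⟩
    sumMaps (sumℕ n) m′ (λ f → ind (P f))
      ∎
    where
    open ≤-Reasoning
    open IsSum
    Sg : IsSum _+_ _*_ 0 (sumMaps (sumℕ n) m)
    Sg = sumMapsℕ-isSum n m
    Sf : IsSum _+_ _*_ 0 (sumMaps (sumℕ n) m′)
    Sf = sumMapsℕ-isSum n m′
    pair : (Fin m → Fin n) → (Fin m′ → Fin n) → ℕ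
    pair g f = ind (Q g) * ind (does (f ≗? Φ g))
    at-most-one : ∀ f → sumMaps (sumℕ n) m (λ g → pair g f) ≤ ind (P f)
    at-most-one f with sumMaps (sumℕ n) m (λ g → pair g f) ℕP.≟ 0
    ... | yes none = ≤-trans (ℕP.≤-reflexive none) z≤n
    ... | no some with sumMaps-witness (sumℕ-witness n) m (λ g → pair g f) some
    ...   | g₀ , pair≢0 with ind-product≢0 (Q g₀) _ pair≢0
    ...     | Qg₀ , f≗Φg₀ = begin
      sumMaps (sumℕ n) m (λ g → pair g f)
        ≤⟨ sumMaps-mono {_≤_ = _≤_} (sumℕ-mono n) m (λ g → ind-product-≤ (Q g) _ _ (λ Qg f≗Φg →
             dec-true (g ≗? g₀) (injective g g₀ Qg Qg₀ (λ i →
               trans (sym (does-sound (f ≗? Φ g) f≗Φg i)) (does-sound (f ≗? Φ g₀) f≗Φg₀ i))))) ⟩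
      sumMaps (sumℕ n) m (λ g → ind (does (g ≗? g₀)))
        ≡⟨ sumMaps-point n m g₀ ⟩
      1
        ≡⟨ cong ind (sym Pf) ⟩
      ind (P f)
        ∎
      where
      Pf : P f ≡ true
      Pf = trans (respects f (Φ g₀) (does-sound (f ≗? Φ g₀) f≗Φg₀)) (maps-to g₀ Qg₀)

  prodℕ : ∀ m → (Fin m → ℕ) → ℕ
  prodℕ zero    f = 1
  prodℕ (suc m) f = f zero * prodℕ m (f ∘ suc)

  prodℕ-mono : ∀ m {f g : Fin m → ℕ} → (∀ i → f i ≤ g i) → prodℕ m f ≤ prodℕ m g
  prodℕ-mono zero    le = ≤-refl
  prodℕ-mono (suc m) le = *-mono-≤ (le zero) (prodℕ-mono m (le ∘ suc))

  prodℕ-pow : ∀ m d (c : Fin m → Bool) → prodℕ m (λ i → if c i then d else 1) ≡ d ^ countFin m c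
  prodℕ-pow zero    d c = refl
  prodℕ-pow (suc m) d c with c zero
  ... | true  = cong (d *_) (prodℕ-pow m d (c ∘ suc))
  ... | false = trans (ℕP.+-identityʳ _) (prodℕ-pow m d (c ∘ suc))

  sumMaps-prodℕ : ∀ n m (h : Fin m → Fin n → ℕ) →
    sumMaps (sumℕ n) m (λ g → prodℕ m (λ x → h x (g x))) ≡ prodℕ m (λ x → sumℕ n (h x))
  sumMaps-prodℕ n zero    h = refl
  sumMaps-prodℕ n (suc m) h = begin
    sumℕ n (λ b → sumMaps (sumℕ n) m (λ φ → h zero b * prodℕ m (λ x → h (suc x) (φ x))))
      ≡⟨ cong-S (sumℕ-isSum n) (λ b → trans (*-hom (sumMapsℕ-isSum n m) (h zero b) _)
                                             (cong (h zero b *_) (sumMaps-prodℕ n m (h ∘ suc)))) ⟩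
    sumℕ n (λ b → h zero b * rest)
      ≡⟨ cong-S (sumℕ-isSum n) (λ b → *-comm (h zero b) rest) ⟩
    sumℕ n (λ b → rest * h zero b)
      ≡⟨ *-hom (sumℕ-isSum n) rest (h zero) ⟩
    rest * sumℕ n (h zero)
      ≡⟨ *-comm rest _ ⟩
    sumℕ n (h zero) * rest
      ∎
    where
    open IsSum
    open ≡-Reasoning
    rest : ℕ
    rest = prodℕ m (λ x → sumℕ n (h (suc x)))

  every : (Fin m → Bool) → Bool
  every {zero}  p = true
  every {suc m} p = p zero ∧ every (p ∘ suc)

  ind-every : ∀ m (p : Fin m → Bool) → ind (every p) ≡ prodℕ m (ind ∘ p)
  ind-every zero    p = refl
  ind-every (suc m) p = trans (ind-∧ (p zero) _) (cong (ind (p zero) *_) (ind-every m (p ∘ suc)))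

  every-sound : ∀ m {p : Fin m → Bool} → every p ≡ true → ∀ x → p x ≡ true
  every-sound (suc m) {p} e x with p zero in p₀ | x
  ... | true | zero  = p₀
  ... | true | suc y = every-sound m e y

module Images where
  open IteratedSums using (IsSum)
  open Decisions
  open NatSums using (sumℕ-isSum; countFin-cong)
  import Data.Nat.Properties as ℕP
  open import Algebra.Properties.CommutativeSemigroup ℕP.+-commutativeSemigroup
    using (x∙yz≈y∙xz)
  open import Data.Bool.Base using (Bool; true; false; if_then_else_; _∨_)
  open import Data.Fin.Base using (Fin; zero; suc)
  open import Data.Fin.Properties using (_≟_; any?)
  open import Data.Nat.Base using (ℕ; zero; suc; _+_; _≤_; z≤n; s≤s)
  open import Data.Nat.Properties using (m≤n⇒m≤1+n)
  open import Data.Empty using (⊥-elim)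
  open import Data.Product using (∃; _,_; proj₁; proj₂)
  open import Function.Base using (_∘_)
  open import Function.Bundles using (_⇔_; mk⇔; module Equivalence)
  open import Relation.Binary.PropositionalEquality
  open import Relation.Nullary using (yes; no; does)
  open import Relation.Nullary.Decidable using (⌊_⌋; isYes≗does)

  private
    variable
      m n n′ : ℕ

  inImage : (Fin m → Fin n) → Fin n → Bool
  inImage f x = ⌊ any? (λ u → f u ≟ x) ⌋

  inImage-sound : ∀ (f : Fin m → Fin n) {x} → inImage f x ≡ true → ∃ λ u → f u ≡ x
  inImage-sound f = isYes-sound (any? _)

  inImage-complete : ∀ (f : Fin m → Fin n) {x} u → f u ≡ x → inImage f x ≡ true
  inImage-complete f u fu≡x = isYes-true (any? _) (u , fu≡x)

  inImage-suc : ∀ (f : Fin (suc m) → Fin n) x → inImage f x ≡ does (f zero ≟ x) ∨ inImage (f ∘ suc) x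
  inImage-suc f x = trans (isYes≗does (any? (λ u → f u ≟ x)))
                          (cong (does (f zero ≟ x) ∨_) (sym (isYes≗does (any? (λ u → f (suc u) ≟ x)))))

  countFin-none : ∀ n → countFin n (λ _ → false) ≡ 0
  countFin-none zero    = refl
  countFin-none (suc n) = countFin-none n

  countFin-insert : ∀ n (a : Fin n) (B : Fin n → Bool) →
    countFin n (λ x → does (a ≟ x) ∨ B x) ≡ (if B a then 0 else 1) + countFin n B
  countFin-insert (suc n) zero B with B zero
  ... | true  = refl
  ... | false = refl
  countFin-insert (suc n) (suc a) B = trans
    (cong ((if B zero then 1 else 0) +_) (countFin-insert n a (B ∘ suc)))
    (x∙yz≈y∙xz (if B zero then 1 else 0) (if B (suc a) then 0 else 1) (countFin n (B ∘ suc)))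

  imageSize-suc : ∀ (f : Fin (suc m) → Fin n) →
    imageSize f ≡ (if inImage (f ∘ suc) (f zero) then 0 else 1) + imageSize (f ∘ suc)
  imageSize-suc {n = n} f = trans (countFin-cong n (inImage-suc f)) (countFin-insert n (f zero) (inImage (f ∘ suc)))

  imageSize≤ : ∀ m (f : Fin m → Fin n) → imageSize f ≤ m
  imageSize≤ {n} zero    f rewrite countFin-none n = z≤n
  imageSize≤ (suc m) f rewrite imageSize-suc f with inImage (f ∘ suc) (f zero)
  ... | true  = m≤n⇒m≤1+n (imageSize≤ m (f ∘ suc))
  ... | false = s≤s (imageSize≤ m (f ∘ suc))

  SameKernel : (Fin m → Fin n) → (Fin m → Fin n′) → Set
  SameKernel f g = ∀ u v → (f u ≡ f v) ⇔ (g u ≡ g v)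

  ≗⇒SameKernel : ∀ {f f′ : Fin m → Fin n} → f ≗ f′ → SameKernel f f′
  ≗⇒SameKernel eq u v =
    mk⇔ (λ e → trans (sym (eq u)) (trans e (eq v))) (λ e → trans (eq u) (trans e (sym (eq v))))

  imageSize-kernel : ∀ m (f : Fin m → Fin n) (g : Fin m → Fin n′) → SameKernel f g → imageSize f ≡ imageSize g
  imageSize-kernel {n} {n′} zero    f g same rewrite countFin-none n | countFin-none n′ = refl
  imageSize-kernel (suc m) f g same rewrite imageSize-suc f | imageSize-suc g = cong₂ _+_
    (cong (λ β → if β then 0 else 1) (isYes-⇔
      (mk⇔ (λ { (u , e) → u , to (same (suc u) zero) e }) (λ { (u , e) → u , from (same (suc u) zero) e }))
      (any? _) (any? _)))
    (imageSize-kernel m (f ∘ suc) (g ∘ suc) (λ u v → same (suc u) (suc v)))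
    where open Equivalence

  -- A map Fin m → Fin m with the same kernel as f: send u to a chosen
  -- preimage of f u.
  preimage : (f : Fin m → Fin n) (x : Fin n) → (∃ λ u → f u ≡ x) → Fin m
  preimage f x w with any? (λ u → f u ≟ x)
  ... | yes (u , _) = u
  ... | no _        = proj₁ w

  preimage-spec : ∀ (f : Fin m → Fin n) x w → f (preimage f x w) ≡ x
  preimage-spec f x w with any? (λ u → f u ≟ x)
  ... | yes (u , fu≡x) = fu≡x
  ... | no _           = proj₂ w

  preimage-cong : ∀ (f : Fin m → Fin n) {x y} → x ≡ y → ∀ w w′ → preimage f x w ≡ preimage f y w′
  preimage-cong f {x} refl w w′ with any? (λ u → f u ≟ x)
  ... | yes _  = refl
  ... | no ¬w  = ⊥-elim (¬w w)

  representative : (Fin m → Fin n) → Fin m → Fin m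
  representative f u = preimage f (f u) (u , refl)

  representative-kernel : (f : Fin m → Fin n) → SameKernel f (representative f)
  representative-kernel f u v = mk⇔
    (λ fu≡fv → preimage-cong f fu≡fv _ _)
    (λ ru≡rv → trans (sym (preimage-spec f (f u) _)) (trans (cong f ru≡rv) (preimage-spec f (f v) _)))

module KernelInvariance (G : Graph) where
  open IteratedSums using (IsSum)
  open Decisions
  open NatSums using (sumℕ-isSum; countFin-cong)
  open EdgeWeights using (hits; hits≡pairHit?; pairHit?)
  open Images
  open import Data.Bool.Base using (false; _∧_; _∨_)
  open import Data.Bool.Properties using (∧-zeroʳ)
  open import Data.Fin.Base using (Fin)
  open import Data.Fin.Properties using (_≟_; any?)
  open import Data.Nat.Base using (ℕ)
  open import Data.Nat.Divisibility using (_∣_; _∣0)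
  open import Data.Product using (_×_; _,_)
  open import Data.Sum using (_⊎_; inj₁; inj₂)
  open import Function.Bundles using (mk⇔; module Equivalence)
  open import Relation.Binary.PropositionalEquality
  open import Relation.Nullary using (yes; no; ¬_)
  open import Relation.Nullary.Decidable using (⌊_⌋)
  open Equivalence

  private
    K : ℕ
    K = k G
    variable
      n n′ : ℕ

  unhit⇒no-pair : ∀ (g : Fin K → Fin n) {x y} → (∀ u → g u ≢ x) ⊎ (∀ u → g u ≢ y) →
    ∀ u v → ¬ ((g u ≡ x × g v ≡ y) ⊎ (g u ≡ y × g v ≡ x))
  unhit⇒no-pair g (inj₁ ¬x) u v (inj₁ (gu≡x , _)) = ¬x u gu≡x
  unhit⇒no-pair g (inj₁ ¬x) u v (inj₂ (_ , gv≡x)) = ¬x v gv≡x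
  unhit⇒no-pair g (inj₂ ¬y) u v (inj₁ (_ , gv≡y)) = ¬y v gv≡y
  unhit⇒no-pair g (inj₂ ¬y) u v (inj₂ (gu≡y , _)) = ¬y u gu≡y

  edgeMult-unhit : ∀ (g : Fin K → Fin n) {x y} → (∀ u → g u ≢ x) ⊎ (∀ u → g u ≢ y) → edgeMult G n g x y ≡ 0
  edgeMult-unhit {n} g {x} {y} missed = trans
    (IsSum.cong-S (sumℕ-isSum K) (λ u → trans (countFin-cong K (λ v → no-edge u v)) (countFin-none K)))
    (IsSum.0-hom (sumℕ-isSum K))
    where
    no-edge : ∀ u v → isEdge G u v ∧ hits x y (g u) (g v) ≡ false
    no-edge u v = trans
      (cong (isEdge G u v ∧_) (trans (hits≡pairHit? x y (g u) (g v))
                                     (isYes-false (pairHit? x y (g u) (g v)) (unhit⇒no-pair g missed u v))))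
      (∧-zeroʳ _)

  edgeMult-kernel : ∀ (f : Fin K → Fin n) (g : Fin K → Fin n′) → SameKernel f g →
    ∀ {u₀ v₀ x y} → g u₀ ≡ x → g v₀ ≡ y → edgeMult G n′ g x y ≡ edgeMult G n f (f u₀) (f v₀)
  edgeMult-kernel f g same {u₀} {v₀} gu₀≡x gv₀≡y = IsSum.cong-S (sumℕ-isSum K) (λ u → countFin-cong K (λ v →
    cong (isEdge G u v ∧_) (cong₂ _∨_ (cong₂ _∧_ (atom u gu₀≡x) (atom v gv₀≡y))
                                      (cong₂ _∧_ (atom u gv₀≡y) (atom v gu₀≡x)))))
    where
    atom : ∀ w {z t} → g z ≡ t → ⌊ g w ≟ t ⌋ ≡ ⌊ f w ≟ f z ⌋
    atom w {z} gz≡t = isYes-⇔ (mk⇔ (λ gw≡t → from (same w z) (trans gw≡t (sym gz≡t)))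
                                   (λ fw≡fz → trans (to (same w z) fw≡fz) gz≡t)) _ _

  evenHom-kernel : ∀ (f : Fin K → Fin n) (g : Fin K → Fin n′) → SameKernel f g →
    IsEvenHom G n f → IsEvenHom G n′ g
  evenHom-kernel f g same (hom , even) = hom′ , even′
    where
    hom′ : IsHom G _ g
    hom′ u v uv gu≡gv = hom u v uv (from (same u v) gu≡gv)
    even′ : ∀ x y → x ≢ y → 2 ∣ edgeMult G _ g x y
    even′ x y x≢y with any? (λ u → g u ≟ x) | any? (λ u → g u ≟ y)
    ... | no ¬x | _     = subst (2 ∣_) (sym (edgeMult-unhit g (inj₁ (λ u gu≡x → ¬x (u , gu≡x))))) (2 ∣0)
    ... | yes _ | no ¬y = subst (2 ∣_) (sym (edgeMult-unhit g (inj₂ (λ u gu≡y → ¬y (u , gu≡y))))) (2 ∣0)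
    ... | yes (u₀ , gu₀≡x) | yes (v₀ , gv₀≡y) =
      subst (2 ∣_) (sym (edgeMult-kernel f g same gu₀≡x gv₀≡y))
        (even (f u₀) (f v₀) (λ fu₀≡fv₀ → x≢y (trans (sym gu₀≡x) (trans (to (same u₀ v₀) fu₀≡fv₀) gv₀≡y))))

-- Σ_{φ : Fin m → Fin n} n^(m - |φ(Fin m)|) ≤ m! n^m : maps with few values
-- are rare.  The weight n^(m - |image|) is computed along the domain.
module CollisionWeights where
  open IteratedSums
  open Decisions
  open NatSums
  open Images using (inImage; imageSize-suc; imageSize≤; countFin-none)
  import Data.Nat.Properties as ℕP
  open import Algebra.Properties.CommutativeSemigroup ℕP.*-commutativeSemigroup
    using (interchange; x∙yz≈y∙xz)
  open import Data.Bool.Base using (true; false; if_then_else_)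
  open import Data.Fin.Base using (Fin; zero; suc)
  open import Data.Nat.Base using (ℕ; zero; suc; _+_; _*_; _^_; _≤_; _!)
  open import Data.Nat.Properties
    using (*-identityʳ; *-comm; *-assoc; ≤-refl; *-monoˡ-≤; +-mono-≤; module ≤-Reasoning)
  open import Function.Base using (_∘_)
  open import Relation.Binary.PropositionalEquality

  collisionWeight : ∀ {m} → (n : ℕ) → (Fin m → Fin n) → ℕ
  collisionWeight {zero}  n f = 1
  collisionWeight {suc m} n f = (if inImage (f ∘ suc) (f zero) then n else 1) * collisionWeight n (f ∘ suc)

  collisionWeight-spec : ∀ m n (f : Fin m → Fin n) → collisionWeight n f * n ^ imageSize f ≡ n ^ m
  collisionWeight-spec zero    n f = cong (1 *_) (cong (n ^_) (countFin-none n))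
  collisionWeight-spec (suc m) n f rewrite imageSize-suc f with inImage (f ∘ suc) (f zero)
  ... | true  = trans (*-assoc n _ _) (cong (n *_) (collisionWeight-spec m n (f ∘ suc)))
  ... | false = trans (cong (_* (n * n ^ imageSize (f ∘ suc))) (ℕP.*-identityˡ (collisionWeight n (f ∘ suc))))
                      (trans (x∙yz≈y∙xz (collisionWeight n (f ∘ suc)) n (n ^ imageSize (f ∘ suc)))
                             (cong (n *_) (collisionWeight-spec m n (f ∘ suc))))

  sumℕ-ones : ∀ n → sumℕ n (λ _ → 1) ≡ n
  sumℕ-ones zero    = refl
  sumℕ-ones (suc n) = cong suc (sumℕ-ones n)

  sumℕ-collision : ∀ m n (φ : Fin m → Fin n) → sumℕ n (λ b → if inImage φ b then n else 1) ≤ suc m * n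
  sumℕ-collision m n φ = begin
    sumℕ n (λ b → if inImage φ b then n else 1)
      ≤⟨ sumℕ-mono n (λ b → pointwise (inImage φ b)) ⟩
    sumℕ n (λ b → n * ind (inImage φ b) + 1)
      ≡⟨ +-hom (λ b → n * ind (inImage φ b)) (λ _ → 1) ⟩
    sumℕ n (λ b → n * ind (inImage φ b)) + sumℕ n (λ _ → 1)
      ≡⟨ cong₂ _+_ (trans (*-hom n _) (cong (n *_) (sym (countFin≡sumℕ n (inImage φ))))) (sumℕ-ones n) ⟩
    n * imageSize φ + n
      ≤⟨ +-mono-≤ (ℕP.*-monoʳ-≤ n (imageSize≤ m φ)) ≤-refl ⟩
    n * m + n
      ≡⟨ trans (ℕP.+-comm (n * m) n) (cong (n +_) (*-comm n m)) ⟩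
    suc m * n
      ∎
    where
    open ≤-Reasoning
    open IsSum (sumℕ-isSum n)
    pointwise : ∀ β → (if β then n else 1) ≤ n * ind β + 1
    pointwise true  = ℕP.≤-trans (ℕP.m≤m+n n 1) (ℕP.≤-reflexive (cong (_+ 1) (sym (*-identityʳ n))))
    pointwise false = ℕP.≤-reflexive (cong (_+ 1) (sym (ℕP.*-zeroʳ n)))

  sumMaps-collisionWeight : ∀ m n → sumMaps (sumℕ n) m (collisionWeight n) ≤ m ! * n ^ m
  sumMaps-collisionWeight zero    n = ≤-refl
  sumMaps-collisionWeight (suc m) n = begin
    sumℕ n (λ b → sumMaps (sumℕ n) m (λ φ → X b φ * collisionWeight n φ))
      ≡⟨ sumℕ-commute Sφ n (λ b φ → X b φ * collisionWeight n φ) ⟩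
    sumMaps (sumℕ n) m (λ φ → sumℕ n (λ b → X b φ * collisionWeight n φ))
      ≡⟨ IsSum.cong-S Sφ (λ φ → factor-out φ) ⟩
    sumMaps (sumℕ n) m (λ φ → sumℕ n (λ b → X b φ) * collisionWeight n φ)
      ≤⟨ sumMaps-mono {_≤_ = _≤_} (sumℕ-mono n) m (λ φ → *-monoˡ-≤ (collisionWeight n φ) (sumℕ-collision m n φ)) ⟩
    sumMaps (sumℕ n) m (λ φ → (suc m * n) * collisionWeight n φ)
      ≡⟨ IsSum.*-hom Sφ (suc m * n) (collisionWeight n) ⟩
    (suc m * n) * sumMaps (sumℕ n) m (collisionWeight n)
      ≤⟨ ℕP.*-monoʳ-≤ (suc m * n) (sumMaps-collisionWeight m n) ⟩
    (suc m * n) * (m ! * n ^ m)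
      ≡⟨ interchange (suc m) n (m !) (n ^ m) ⟩
    suc m ! * n ^ suc m
      ∎
    where
    open ≤-Reasoning
    Sφ : IsSum _+_ _*_ 0 (sumMaps (sumℕ n) m)
    Sφ = sumMaps-isSum (sumℕ-isSum n) m
    X : Fin n → (Fin m → Fin n) → ℕ
    X b φ = if inImage φ b then n else 1
    factor-out : ∀ φ → sumℕ n (λ b → X b φ * collisionWeight n φ) ≡ sumℕ n (λ b → X b φ) * collisionWeight n φ
    factor-out φ = trans (IsSum.cong-S (sumℕ-isSum n) (λ b → *-comm (X b φ) _))
                         (trans (IsSum.*-hom (sumℕ-isSum n) (collisionWeight n φ) (λ b → X b φ))
                                (*-comm (collisionWeight n φ) _))

module Residues where
  open Decisions using (ind)
  import Data.Nat.Properties as ℕP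
  open import Data.Fin.Base using (toℕ)
  open import Data.Nat.Base using (ℕ; zero; suc; _+_; _*_; _≤_; _<_; z≤n; s≤s; NonZero)
  open import Data.Nat.DivMod using (_%_; _/_; m≡m%n+[m/n]*n; [m+n]%n≡m%n; m<n⇒m%n≡m)
  open import Data.Nat.Properties using (_≟_; +-mono-≤; m≤m+n; m≤n+m; module ≤-Reasoning)
  open import Function.Base using (_∘_)
  open import Relation.Binary.PropositionalEquality
  open import Relation.Nullary using (does)
  open import Relation.Nullary.Decidable using (dec-true)

  sumBelow : ℕ → (ℕ → ℕ) → ℕ
  sumBelow zero    h = 0
  sumBelow (suc n) h = h 0 + sumBelow n (h ∘ suc)

  sumℕ-toℕ : ∀ n (h : ℕ → ℕ) → sumℕ n (h ∘ toℕ) ≡ sumBelow n h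
  sumℕ-toℕ zero    h = refl
  sumℕ-toℕ (suc n) h = cong (h 0 +_) (sumℕ-toℕ n (h ∘ suc))

  sumBelow-cong : ∀ n {h h′ : ℕ → ℕ} → (∀ i → h i ≡ h′ i) → sumBelow n h ≡ sumBelow n h′
  sumBelow-cong zero    eq = refl
  sumBelow-cong (suc n) eq = cong₂ _+_ (eq 0) (sumBelow-cong n (eq ∘ suc))

  sumBelow-+ : ∀ a b (h : ℕ → ℕ) → sumBelow (a + b) h ≡ sumBelow a h + sumBelow b (λ i → h (a + i))
  sumBelow-+ zero    b h = refl
  sumBelow-+ (suc a) b h = trans (cong (h 0 +_) (sumBelow-+ a b (h ∘ suc))) (sym (ℕP.+-assoc (h 0) _ _))

  sumBelow-≥ : ∀ n (h : ℕ → ℕ) r → r < n → h r ≤ sumBelow n h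
  sumBelow-≥ (suc n) h zero    _         = m≤m+n (h 0) _
  sumBelow-≥ (suc n) h (suc r) (s≤s r<n) = ℕP.≤-trans (sumBelow-≥ n (h ∘ suc) r r<n) (m≤n+m _ (h 0))

  sumBelow-periodic : ∀ M d e (h : ℕ → ℕ) → 1 ≤ sumBelow M h → (∀ i → h (M + i) ≡ h i) →
    d ≤ sumBelow (d * M + e) h
  sumBelow-periodic M zero    e h one periodic = z≤n
  sumBelow-periodic M (suc d) e h one periodic = begin
    suc d
      ≤⟨ +-mono-≤ one (sumBelow-periodic M d e h one periodic) ⟩
    sumBelow M h + sumBelow (d * M + e) h
      ≡⟨ cong (sumBelow M h +_) (sumBelow-cong (d * M + e) (sym ∘ periodic)) ⟩
    sumBelow M h + sumBelow (d * M + e) (λ i → h (M + i))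
      ≡⟨ sym (sumBelow-+ M (d * M + e) h) ⟩
    sumBelow (M + (d * M + e)) h
      ≡⟨ cong (λ s → sumBelow s h) (sym (ℕP.+-assoc M (d * M) e)) ⟩
    sumBelow (suc d * M + e) h
      ∎
    where open ≤-Reasoning

  residue-count : ∀ n M .{{_ : NonZero M}} r → r < M → n / M ≤ sumℕ n (λ y → ind (does (toℕ y % M ≟ r)))
  residue-count n M r r<M = begin
    n / M
      ≤⟨ sumBelow-periodic M (n / M) (n % M) inClass one periodic ⟩
    sumBelow (n / M * M + n % M) inClass
      ≡⟨ cong (λ s → sumBelow s inClass) (trans (ℕP.+-comm _ (n % M)) (sym (m≡m%n+[m/n]*n n M))) ⟩
    sumBelow n inClass
      ≡⟨ sym (sumℕ-toℕ n inClass) ⟩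
    sumℕ n (inClass ∘ toℕ)
      ∎
    where
    open ≤-Reasoning
    inClass : ℕ → ℕ
    inClass i = ind (does (i % M ≟ r))
    one : 1 ≤ sumBelow M inClass
    one = subst (_≤ sumBelow M inClass) (cong ind (dec-true (r % M ≟ r) (m<n⇒m%n≡m r<M)))
                (sumBelow-≥ M inClass r r<M)
    periodic : ∀ i → inClass (M + i) ≡ inClass i
    periodic i = cong (λ j → ind (does (j ≟ r))) (trans (cong (_% M) (ℕP.+-comm M i)) ([m+n]%n≡m%n i M))

module CountBounds (G : Graph) where
  open IteratedSums
  open Decisions
  open NatSums
  open Counting
  open Images
  open CollisionWeights
  open Residues
  open EdgeProduct G using (evenHom?)
  open Expectation G using (evenHomCount)
  open KernelInvariance G using (evenHom-kernel)
  import Data.Nat.Properties as ℕP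
  open import Data.Bool.Base using (Bool; true; false; if_then_else_)
  open import Data.Fin.Base using (Fin; zero; suc; toℕ)
  open import Data.Fin.Properties using (_≟_; toℕ-injective; toℕ<n)
  open import Data.Nat.Base as ℕ using (ℕ; zero; suc; _+_; _*_; _^_; _∸_; _≤_; z≤n; _!; NonZero)
  open import Data.Nat.DivMod using (_%_; _/_)
  open import Data.Nat.Properties
    using (*-comm; *-zeroʳ; *-identityʳ; ^-distribˡ-+-*; ^-monoʳ-≤; m^n≢0; *-cancelʳ-≤;
           +-monoˡ-≤; m∸n+n≡m; module ≤-Reasoning)
  open import Data.Product using (_,_)
  open import Function.Base using (_∘_)
  open import Function.Bundles using (mk⇔)
  open import Relation.Binary.PropositionalEquality
  open import Relation.Nullary using (yes; no; does)
  open import Relation.Nullary.Decidable using (⌊_⌋)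

  private
    K : ℕ
    K = k G

  evenHom-representative : ∀ {n} (φ : Fin K → Fin n) → IsEvenHom G n φ → IsEvenHom G K (representative φ)
  evenHom-representative φ = evenHom-kernel φ (representative φ) (representative-kernel φ)

  evenHomCount-none : NoEvenHom G → ∀ n → evenHomCount n ≡ 0
  evenHomCount-none noEven n = trans (IsSum.cong-S (sumMapsℕ-isSum n K) none) (IsSum.0-hom (sumMapsℕ-isSum n K))
    where
    none : ∀ φ → ind ⌊ evenHom? φ ⌋ ≡ 0
    none φ = cong ind (isYes-false (evenHom? φ) (λ ev → noEven (representative φ) (evenHom-representative φ ev)))

  -- If q ≤ K - |f(V)| for every even f : V → [K], then every even φ has
  -- collision weight ≥ n^q, so #even · n^q ≤ K! n^K.
  evenHomCount-upper : ∀ q → (∀ f → IsEvenHom G K f → q ≤ K ∸ imageSize f) →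
    ∀ n .{{_ : NonZero n}} → evenHomCount n * n ^ q ≤ K ! * n ^ K
  evenHomCount-upper q minimal n = begin
    evenHomCount n * n ^ q
      ≡⟨ *-comm (evenHomCount n) (n ^ q) ⟩
    n ^ q * evenHomCount n
      ≡⟨ sym (IsSum.*-hom (sumMapsℕ-isSum n K) (n ^ q) _) ⟩
    sumMaps (sumℕ n) K (λ φ → n ^ q * ind ⌊ evenHom? φ ⌋)
      ≤⟨ sumMaps-mono {_≤_ = _≤_} (sumℕ-mono n) K weight-bound ⟩
    sumMaps (sumℕ n) K (collisionWeight n)
      ≤⟨ sumMaps-collisionWeight K n ⟩
    K ! * n ^ K
      ∎
    where
    open ≤-Reasoning
    weight-bound : ∀ φ → n ^ q * ind ⌊ evenHom? φ ⌋ ≤ collisionWeight n φ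
    weight-bound φ with evenHom? φ
    ... | no _  = ℕP.≤-trans (ℕP.≤-reflexive (*-zeroʳ (n ^ q))) z≤n
    ... | yes ev = ℕP.≤-trans (ℕP.≤-reflexive (*-identityʳ (n ^ q)))
        (*-cancelʳ-≤ (n ^ q) (collisionWeight n φ) (n ^ s) {{m^n≢0 n s}} (begin
          n ^ q * n ^ s               ≡⟨ sym (^-distribˡ-+-* n q s) ⟩
          n ^ (q + s)                 ≤⟨ ^-monoʳ-≤ n q+s≤K ⟩
          n ^ K                       ≡⟨ sym (collisionWeight-spec K n φ) ⟩
          collisionWeight n φ * n ^ s ∎))
      where
      s : ℕ
      s = imageSize φ
      q≤K∸s : q ≤ K ∸ s
      q≤K∸s = subst (λ t → q ≤ K ∸ t)
        (sym (imageSize-kernel K φ (representative φ) (representative-kernel φ)))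
        (minimal (representative φ) (evenHom-representative φ ev))
      q+s≤K : q + s ≤ K
      q+s≤K = ℕP.≤-trans (+-monoˡ-≤ s q≤K∸s) (ℕP.≤-reflexive (m∸n+n≡m (imageSize≤ K φ)))

  -- Lower bound: from one even f₀ : V(G) → [K], the maps g ∘ f₀ with g(x) in
  -- the residue class of x modulo K + 1 (for x in the image of f₀, and
  -- g(x) = 0 otherwise) are distinct even homomorphisms into K_n.
  module ResidueFamily (f₀ : Fin K → Fin K) (ev₀ : IsEvenHom G K f₀) (n′ : ℕ) where
    n M : ℕ
    n = suc n′
    M = suc K

    allowed : Fin K → Fin n → Bool
    allowed x y = if inImage f₀ x then does (toℕ y % M ℕP.≟ toℕ x) else does (y ≟ zero)

    Allowed : (Fin K → Fin n) → Bool
    Allowed g = every (λ x → allowed x (g x))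

    allowed-image : ∀ g → Allowed g ≡ true → ∀ u → toℕ (g (f₀ u)) % M ≡ toℕ (f₀ u)
    allowed-image g ok u with every-sound K ok (f₀ u)
    ... | ok-u rewrite inImage-complete f₀ u refl = does-sound (_ ℕP.≟ _) ok-u

    allowed-outside : ∀ g → Allowed g ≡ true → ∀ x → inImage f₀ x ≡ false → g x ≡ zero
    allowed-outside g ok x outside with every-sound K ok x
    ... | ok-x rewrite outside = does-sound (g x ≟ zero) ok-x

    -- g ∘ f₀ has the kernel of f₀, since g separates the values of f₀.
    allowed-kernel : ∀ g → Allowed g ≡ true → SameKernel f₀ (g ∘ f₀)
    allowed-kernel g ok u v = mk⇔ (cong g) (λ gu≡gv → toℕ-injective (begin
      toℕ (f₀ u)             ≡⟨ sym (allowed-image g ok u) ⟩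
      toℕ (g (f₀ u)) % M     ≡⟨ cong (λ y → toℕ y % M) gu≡gv ⟩
      toℕ (g (f₀ v)) % M     ≡⟨ allowed-image g ok v ⟩
      toℕ (f₀ v)             ∎))
      where open ≡-Reasoning

    allowed-injective : ∀ g g′ → Allowed g ≡ true → Allowed g′ ≡ true → g ∘ f₀ ≗ g′ ∘ f₀ → g ≗ g′
    allowed-injective g g′ ok ok′ eq x with inImage f₀ x in x∈im
    ... | true  with inImage-sound f₀ x∈im
    ...   | u , refl = eq u
    allowed-injective g g′ ok ok′ eq x | false =
      trans (allowed-outside g ok x x∈im) (sym (allowed-outside g′ ok′ x x∈im))

    column-count : ∀ x → (if inImage f₀ x then n / M else 1) ≤ sumℕ n (λ y → ind (allowed x y))
    column-count x with inImage f₀ x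
    ... | true  = residue-count n M (toℕ x) (ℕP.m<n⇒m<1+n (toℕ<n x))
    ... | false = ℕP.≤-reflexive (sym (sumℕ-point n zero))

    -- The allowed maps form a product set.
    allowed-count : (n / M) ^ imageSize f₀ ≤ countMaps n K Allowed
    allowed-count = begin
      (n / M) ^ imageSize f₀
        ≡⟨ sym (prodℕ-pow K (n / M) (inImage f₀)) ⟩
      prodℕ K (λ x → if inImage f₀ x then n / M else 1)
        ≤⟨ prodℕ-mono K column-count ⟩
      prodℕ K (λ x → sumℕ n (λ y → ind (allowed x y)))
        ≡⟨ sym (sumMaps-prodℕ n K (λ x y → ind (allowed x y))) ⟩
      sumMaps (sumℕ n) K (λ g → prodℕ K (λ x → ind (allowed x (g x))))
        ≡⟨ sym (IsSum.cong-S (sumMapsℕ-isSum n K) (λ g → ind-every K (λ x → allowed x (g x)))) ⟩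
      countMaps n K Allowed
        ∎
      where open ≤-Reasoning

    evenHomCount-lower : (n / M) ^ imageSize f₀ ≤ evenHomCount n
    evenHomCount-lower = ℕP.≤-trans allowed-count (injection-count Allowed (λ φ → ⌊ evenHom? φ ⌋) (_∘ f₀)
      allowed-injective
      (λ g ok → isYes-true (evenHom? _) (evenHom-kernel f₀ (g ∘ f₀) (allowed-kernel g ok) ev₀))
      (λ f f′ f≗f′ → isYes-⇔ (mk⇔ (evenHom-kernel f f′ (≗⇒SameKernel f≗f′))
                                  (evenHom-kernel f′ f (≗⇒SameKernel (sym ∘ f≗f′))))
                              (evenHom? f) (evenHom? f′)))

module Asymptotics (G : Graph) where
  open Fractions
  open Images using (imageSize≤)
  open Expectation G using (evenHomCount; expect-t≡)
  open CountBounds G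
  import Data.Nat.Properties as ℕP
  open import Algebra.Properties.CommutativeSemigroup ℕP.*-commutativeSemigroup
    using (interchange; x∙yz≈y∙xz)
  open import Data.Fin.Base using (Fin)
  open import Data.Integer.Base as ℤ using ()
  open import Data.Nat.Base as ℕ using (ℕ; zero; suc; _+_; _*_; _^_; _∸_; _≤_; _!; NonZero)
  open import Data.Nat.DivMod using (_%_; _/_; m≡m%n+[m/n]*n; m%n<n; m≥n⇒m/n>0)
  open import Data.Nat.Tactic.RingSolver using (solve-∀)
  open import Data.Nat.Properties
    using (m^n≢0; ^-distribˡ-+-*; ^-monoˡ-≤; *-monoˡ-≤; *-monoʳ-≤; +-monoˡ-≤; m+[n∸m]≡n;
           module ≤-Reasoning)
  open import Data.Rational.Base as ℚ using (ℚ; 0ℚ) renaming (_/_ to _÷_)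
  import Data.Rational.Properties as ℚP
  open import Relation.Binary.PropositionalEquality

  private
    K : ℕ
    K = k G

  ^-distribʳ-* : ∀ a b s → (a * b) ^ s ≡ a ^ s * b ^ s
  ^-distribʳ-* a b zero    = refl
  ^-distribʳ-* a b (suc s) = trans (cong ((a * b) *_) (^-distribʳ-* a b s)) (interchange a b (a ^ s) (b ^ s))

  ≤-twice-quotient : ∀ n M .{{_ : NonZero M}} → M ≤ n → n ≤ (2 * M) * (n / M)
  ≤-twice-quotient n M M≤n = begin
    n                            ≡⟨ m≡m%n+[m/n]*n n M ⟩
    n % M + n / M * M            ≤⟨ +-monoˡ-≤ (n / M * M) (ℕP.≤-trans (ℕP.<⇒≤ (m%n<n n M)) M≤[n/M]M) ⟩
    n / M * M + n / M * M        ≡⟨ double (n / M) M ⟩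
    (2 * M) * (n / M)            ∎
    where
    open ≤-Reasoning
    M≤[n/M]M : M ≤ n / M * M
    M≤[n/M]M = ℕP.≤-trans (ℕP.≤-reflexive (sym (ℕP.*-identityˡ M))) (*-monoˡ-≤ M (m≥n⇒m/n>0 M≤n))
    double : ∀ d M → d * M + d * M ≡ (2 * M) * d
    double = solve-∀

  -- The constants: c = 1 / (2(K+1))^|f₀(V)| for an optimal f₀, and C = K!.
  lowerConstant : (Fin K → Fin K) → ℚ
  lowerConstant f₀ = (ℤ.+ 1 ÷ (2 * suc K) ^ imageSize f₀) {{m^n≢0 (2 * suc K) (imageSize f₀)}}

  lowerConstant-positive : ∀ f₀ → 0ℚ ℚ.< lowerConstant f₀
  lowerConstant-positive f₀ = positive-/ 1 _ {{m^n≢0 (2 * suc K) (imageSize f₀)}} (ℕ.s≤s ℕ.z≤n)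

  upperConstant : ℚ
  upperConstant = ℤ.+ (K !) ÷ 1

  upperConstant-positive : 0ℚ ℚ.< upperConstant
  upperConstant-positive = positive-/ (K !) 1 (ℕ.>-nonZero⁻¹ (K !) {{K ℕP.!≢0}})

  expect-upper : ∀ q → (∀ f → IsEvenHom G K f → q ≤ K ∸ imageSize f) →
    ∀ n .{{_ : NonZero n}} → expect-t G n ℚ.≤ upperConstant ℚ.* invPow n q
  expect-upper q minimal n = begin
    expect-t G n                    ≡⟨ expect-t≡ n ⟩
    ℤ.+ evenHomCount n ÷ n ^ K      ≤⟨ /-≤ (ℤ.+ evenHomCount n) (ℤ.+ (K !)) (n ^ K) (n ^ q)
                                          (pos-*-mono (evenHomCount n) (n ^ q) (K !) (n ^ K)
                                                      (evenHomCount-upper q minimal n)) ⟩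
    ℤ.+ (K !) ÷ n ^ q               ≡⟨ sym (/1-* (ℤ.+ (K !)) (n ^ q)) ⟩
    upperConstant ℚ.* invPow n q    ∎
    where
    open ℚP.≤-Reasoning
    instance
      n^K≢0 : NonZero (n ^ K)
      n^K≢0 = m^n≢0 n K
      n^q≢0 : NonZero (n ^ q)
      n^q≢0 = m^n≢0 n q

  module _ (f₀ : Fin K → Fin K) (ev₀ : IsEvenHom G K f₀) (q : ℕ) (K∸s≡q : K ∸ imageSize f₀ ≡ q) where
    private
      s M D : ℕ
      s = imageSize f₀
      M = suc K
      D = (2 * M) ^ s
      instance
        D≢0 : NonZero D
        D≢0 = m^n≢0 (2 * M) s

    power-bound : ∀ n → M ≤ n → n ^ K ≤ evenHomCount n * (D * n ^ q)
    power-bound n@(suc n′) M≤n = begin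
      n ^ K                              ≡⟨ cong (n ^_) (sym s+q≡K) ⟩
      n ^ (s + q)                        ≡⟨ ^-distribˡ-+-* n s q ⟩
      n ^ s * n ^ q                      ≤⟨ *-monoˡ-≤ (n ^ q) (^-monoˡ-≤ s (≤-twice-quotient n M M≤n)) ⟩
      ((2 * M) * (n / M)) ^ s * n ^ q    ≡⟨ cong (_* n ^ q) (^-distribʳ-* (2 * M) (n / M) s) ⟩
      (D * (n / M) ^ s) * n ^ q          ≤⟨ *-monoˡ-≤ (n ^ q) (*-monoʳ-≤ D (ResidueFamily.evenHomCount-lower f₀ ev₀ n′)) ⟩
      (D * evenHomCount n) * n ^ q       ≡⟨ trans (ℕP.*-assoc D _ _) (x∙yz≈y∙xz D (evenHomCount n) (n ^ q)) ⟩
      evenHomCount n * (D * n ^ q)       ∎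
      where
      open ≤-Reasoning
      s+q≡K : s + q ≡ K
      s+q≡K = trans (cong (s +_) (sym K∸s≡q)) (m+[n∸m]≡n (imageSize≤ K f₀))

    expect-lower : ∀ n .{{_ : NonZero n}} → M ≤ n → lowerConstant f₀ ℚ.* invPow n q ℚ.≤ expect-t G n
    expect-lower n M≤n = begin
      lowerConstant f₀ ℚ.* invPow n q  ≡⟨ /-* (ℤ.+ 1) (ℤ.+ 1) D (n ^ q) ⟩
      ℤ.+ 1 ÷ (D * n ^ q)              ≤⟨ /-≤ (ℤ.+ 1) (ℤ.+ evenHomCount n) (D * n ^ q) (n ^ K)
                                             (pos-*-mono 1 (n ^ K) (evenHomCount n) (D * n ^ q)
                                               (ℕP.≤-trans (ℕP.≤-reflexive (ℕP.*-identityˡ (n ^ K)))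
                                                           (power-bound n M≤n))) ⟩
      ℤ.+ evenHomCount n ÷ n ^ K       ≡⟨ sym (expect-t≡ n) ⟩
      expect-t G n                     ∎
      where
      open ℚP.≤-Reasoning
      instance
        n^K≢0 : NonZero (n ^ K)
        n^K≢0 = m^n≢0 n K
        n^q≢0 : NonZero (n ^ q)
        n^q≢0 = m^n≢0 n q
        Dn^q≢0 : NonZero (D * n ^ q)
        Dn^q≢0 = ℕP.m*n≢0 D (n ^ q)

  expect-vanishes : NoEvenHom G → ∀ n .{{_ : NonZero n}} → expect-t G n ≡ 0ℚ
  expect-vanishes noEven n = begin
    expect-t G n                ≡⟨ expect-t≡ n ⟩
    ℤ.+ evenHomCount n ÷ n ^ K  ≡⟨ cong (λ c → ℤ.+ c ÷ n ^ K) (evenHomCount-none noEven n) ⟩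
    ℤ.+ 0 ÷ n ^ K               ≡⟨ ℚP.0/n≡0 (n ^ K) ⟩
    0ℚ                          ∎
    where
    open ≡-Reasoning
    instance
      n^K≢0 : NonZero (n ^ K)
      n^K≢0 = m^n≢0 n K

open import Data.Nat using (ℕ; suc; NonZero; _≤_)
open import Data.Rational using (ℚ; 0ℚ; _*_; _<_) renaming (_≤_ to _≤ℚ_)
open import Data.Product using (_×_; _,_; ∃-syntax)
open import Relation.Binary.PropositionalEquality using (_≡_)

mainTheorem19 : (G : Graph) →
    ((q : ℕ) → IsP G q →
      ∃[ c ] ∃[ C ] ∃[ N ] (0ℚ < c × 0ℚ < C ×
        (∀ (n : ℕ) .{{_ : NonZero n}} → N ≤ n →
          (c * invPow n q ≤ℚ expect-t G n) × (expect-t G n ≤ℚ C * invPow n q))))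
    × (NoEvenHom G →
      ∃[ N ] (∀ (n : ℕ) .{{_ : NonZero n}} → N ≤ n → expect-t G n ≡ 0ℚ))
mainTheorem19 G =
  (λ { q ((f₀ , ev₀ , K∸s≡q) , minimal) →
         lowerConstant f₀ , upperConstant , suc (k G) ,
         lowerConstant-positive f₀ , upperConstant-positive ,
         λ n M≤n → expect-lower f₀ ev₀ q K∸s≡q n M≤n , expect-upper q minimal n }) ,
  (λ noEven → 1 , λ n _ → expect-vanishes noEven n)
  where open Asymptotics G
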